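{- Let $r\ge1$, $\ell\ge1$, and let $\mathcal{C}$ be the set of compositions $d=(d_1,\ldots,d_r)$ of $\ell$ into $r$ nonnegative parts. For $d\in\mathcal{C}$ and $n\ge0$ let $f_{n,d}(q)$ be the generating function $\sum q^{|\Lambda|}$ of cylindric partitions with profile $d$ and all parts at most $n$, and put $P_{n,d}(q)=(q^r;q^r)_nf_{n,d}(q)$. Fix $c\in\mathcal{C}$ and let $f_{=n,c}(q)$ be the generating function $\sum q^{|\Lambda|}$ of cylindric partitions $\Lambda$ with profile $c$ and $\max(\Lambda)=n$. Then $f_{=n,c}(q)=P_{=n,c}(q)/(q^r;q^r)_n$, where $P_{=0,c}(q)=1$ and, for $n\ge1$, \[ P_{=n,c}(q)=q^{nr}P_{n-1,c}(q)+\sum_{d\in\mathcal{C},\,d\ne c}q^{n\Delta(c,d)}P_{n-1,d}(q). \]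
   Context: A cylindric partition with profile $c=(c_1,\ldots,c_r)$ is a tuple $\Lambda=(\lambda^{(1)},\ldots,\lambda^{(r)})$ of integer partitions such that for all $j\ge1$: $\lambda^{(i)}_j\ge\lambda^{(i+1)}_{j+c_{i+1}}$ for $1\le i\le r-1$, and $\lambda^{(r)}_j\ge\lambda^{(1)}_{j+c_1}$ (missing parts taken as $0$); $|\Lambda|$ is the sum of all parts and $\max(\Lambda)$ the largest part ($0$ for the empty one). For compositions $c,d$ with $r$ parts, $\Delta(c,d)=\sum_{k=2}^{r}(k-1)(d_k-c_k)+r\max\{0,\ c_r-d_r,\ (c_r+c_{r-1})-(d_r+d_{r-1}),\ \ldots,\ (c_r+\cdots+c_2)-(d_r+\cdots+d_2)\}$. $(a;q)_n=\prod_{j=1}^n(1-aq^{j-1})$. -}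

module Defs where

open import Data.Bool using (Bool; true; false; _∧_; T)
open import Data.Nat as ℕ using (ℕ; zero; suc; _≤ᵇ_; _≡ᵇ_; _⊔_; _∸_)
open import Data.Integer as ℤ using (ℤ; +_; _-_)
open import Data.List as L using (List; []; _∷_; _++_; [_]; length; upTo; concat; map; foldr; all; drop; zipWith; filter; concatMap)
open import Data.Vec as V using (Vec; toList)
open import Data.Product using (Σ)
open import Relation.Nullary.Decidable using (⌊_⌋)
open import Relation.Nullary using (¬_; yes; no)
import Data.Vec.Properties as VP

positive : List ℕ → Bool
positive = all (λ x → 1 ≤ᵇ x)

decreasing : List ℕ → Bool
decreasing [] = true
decreasing (x ∷ []) = true
decreasing (x ∷ y ∷ xs) = (y ≤ᵇ x) ∧ decreasing (y ∷ xs)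

isPartition : List ℕ → Bool
isPartition xs = positive xs ∧ decreasing xs

-- part λ j = λ_j (1-based), missing parts are 0.
nth0 : List ℕ → ℕ → ℕ
nth0 [] _ = 0
nth0 (x ∷ xs) zero = x
nth0 (x ∷ xs) (suc i) = nth0 xs i

part : List ℕ → ℕ → ℕ
part xs j = nth0 xs (j ∸ 1)

-- dom k a b : for all j ≥ 1, a_j ≥ b_{j+k}.  For j > length b both sides
-- give b_{j+k} = 0, so checking j = 1 .. length b is exactly this condition.
dom : ℕ → List ℕ → List ℕ → Bool
dom k a b = all (λ j → part b (j ℕ.+ k) ≤ᵇ part a j) (map suc (upTo (length b)))

rot : {A : Set} → List A → List A
rot [] = []
rot (x ∷ xs) = xs ++ [ x ]

-- checks dom (c_{i+1}) λ^(i) λ^(i+1) for consecutive (cyclic) pairs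
pairsOK : List (List ℕ) → List (List ℕ) → List ℕ → Bool
pairsOK (a ∷ as) (b ∷ bs) (k ∷ ks) = dom k a b ∧ pairsOK as bs ks
pairsOK _ _ _ = true

isCylindric : {r : ℕ} → Vec ℕ r → Vec (List ℕ) r → Bool
isCylindric c Λ =
  all isPartition (toList Λ) ∧ pairsOK (toList Λ) (rot (toList Λ)) (rot (toList c))

size : {r : ℕ} → Vec (List ℕ) r → ℕ
size Λ = L.sum (concat (toList Λ))

maxPart : {r : ℕ} → Vec (List ℕ) r → ℕ
maxPart Λ = foldr _⊔_ 0 (concat (toList Λ))

CPbounded : (r : ℕ) → Vec ℕ r → ℕ → ℕ → Set
CPbounded r d n m = Σ (Vec (List ℕ) r) λ Λ →
  T (isCylindric d Λ ∧ (maxPart Λ ≤ᵇ n) ∧ (size Λ ≡ᵇ m))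

CPexact : (r : ℕ) → Vec ℕ r → ℕ → ℕ → Set
CPexact r c n m = Σ (Vec (List ℕ) r) λ Λ →
  T (isCylindric c Λ ∧ (maxPart Λ ≡ᵇ n) ∧ (size Λ ≡ᵇ m))

Series : Set
Series = ℕ → ℤ

sumℤ : List ℤ → ℤ
sumℤ = foldr ℤ._+_ (+ 0)

_⊕_ : Series → Series → Series
(F ⊕ G) m = F m ℤ.+ G m

_⊖_ : Series → Series → Series
(F ⊖ G) m = F m ℤ.- G m

_⊛_ : Series → Series → Series
(F ⊛ G) m = sumℤ (map (λ i → F i ℤ.* G (m ∸ i)) (upTo (suc m)))

monomial : ℕ → Series
monomial k m = if⌊ k ℕ.≟ m ⌋
  where
  if⌊_⌋ : _ → ℤ
  if⌊ yes _ ⌋ = + 1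
  if⌊ no _ ⌋ = + 0

one : Series
one = monomial 0

zeroS : Series
zeroS _ = + 0

_^S_ : Series → ℕ → Series
F ^S zero = one
F ^S suc n = F ⊛ (F ^S n)

qPoch : Series → Series → ℕ → Series
qPoch a q zero = one
qPoch a q (suc n) = qPoch a q n ⊛ (one ⊖ (a ⊛ (q ^S n)))

qS : Series
qS = monomial 1

pochR : ℕ → ℕ → Series
pochR r n = qPoch (qS ^S r) (qS ^S r) n

fromℕcoeffs : (ℕ → ℕ) → Series
fromℕcoeffs f m = + f m

_≈S_ : Series → Series → Set
F ≈S G = ∀ m → F m ≡ G m
  where open import Relation.Binary.PropositionalEquality using (_≡_)

boxVecs : (r ℓ : ℕ) → List (Vec ℕ r)
boxVecs zero ℓ = V.[] ∷ []
boxVecs (suc r) ℓ = concatMap (λ x → map (x V.∷_) (boxVecs r ℓ)) (upTo (suc ℓ))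

vsum : {r : ℕ} → Vec ℕ r → ℕ
vsum v = L.sum (toList v)

compositionsExcept : (r ℓ : ℕ) → Vec ℕ r → List (Vec ℕ r)
compositionsExcept r ℓ c =
  filter (λ d → (vsum d ℕ.≟ ℓ) Relation.Nullary.Decidable.×-dec
                Relation.Nullary.Decidable.¬? (VP.≡-dec ℕ._≟_ d c))
         (boxVecs r ℓ)

-- Δ(c,d) = Σ_{k=2}^r (k-1)(d_k - c_k)
--          + r max{0, Σ_{k=j}^r (c_k - d_k) : j = 2..r}
Δ : {r : ℕ} → Vec ℕ r → Vec ℕ r → ℤ
Δ {r} c d = sumℤ (map (λ i → + i ℤ.* ((+ nth0 ds i) ℤ.- (+ nth0 cs i))) (upTo r))
            ℤ.+ (+ r) ℤ.* foldr ℤ._⊔_ (+ 0) (map S (map suc (upTo (r ∸ 1))))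
  where
  cs = toList c
  ds = toList d
  diffs : List ℤ
  diffs = zipWith (λ x y → (+ x) ℤ.- (+ y)) cs ds
  -- S t = Σ_{k=t+1}^r (c_k - d_k)   (0-based start index t)
  S : ℕ → ℤ
  S t = sumℤ (drop t diffs)

Pbounded : (r : ℕ) → (ℕ → Vec ℕ r → ℕ → ℕ) → ℕ → Vec ℕ r → Series
Pbounded r f n d = pochR r n ⊛ fromℕcoeffs (f n d)

sumS : List Series → Series
sumS = foldr _⊕_ zeroS

Pexact : (r ℓ : ℕ) → (ℕ → Vec ℕ r → ℕ → ℕ) → Vec ℕ r → ℕ → Series
Pexact r ℓ f c zero = one
Pexact r ℓ f c (suc n) =
  (monomial (suc n ℕ.* r) ⊛ Pbounded r f n c)
  ⊕ sumS (map (λ d → monomial ℤ.∣ (+ suc n) ℤ.* Δ c d ∣ ⊛ Pbounded r f n d)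
              (compositionsExcept r ℓ c))

-- Let Λ have profile c and largest part N.  Write its i-th component as
-- m_i parts N followed by a partition μ_i with parts at most N − 1.  Two consecutive padded
-- components satisfy the profile entry c_i exactly when the unpadded ones satisfy
-- d_i = c_i + m_{i−1} − m_i, so μ is cylindric of profile d, a composition of ℓ.
-- If every m_i ≥ 1 we instead remove a single N from every component and keep the profile c:
-- this gives the term q^{Nr} f_{N,c}.  Otherwise some m_i = 0, and then the m_i are determined
-- by (c, d): m_i = M − S_i with S_i the suffix sums of c − d and M = max(0, S_1, …), so the
-- removed weight N Σ m_i equals N Δ(c, d) (an Abel summation), and d ≠ c.  Hence
--   f_{=N,c} = q^{Nr} f_{N,c} + Σ_{d ≠ c} q^{NΔ(c,d)} f_{N−1,d},   f_{N,c} = f_{N−1,c} + f_{=N,c},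
-- and multiplying by (q^r;q^r)_N = (q^r;q^r)_{N−1} (1 − q^{Nr}) gives the recurrence.

module Submission where

open import Defs
open import Data.Bool using (Bool; true; false; _∧_; not; T; if_then_else_)
import Data.Bool.Properties as Boolₚ
open import Data.Empty using (⊥-elim)
open import Data.Unit using (⊤; tt)
open import Data.Product using (Σ; _×_; _,_; proj₁; proj₂)
open import Data.Sum using (_⊎_; inj₁; inj₂)
open import Data.Nat as ℕ using (ℕ; zero; suc; _+_; _*_; _∸_; _≤_; _<_; _⊔_; z≤n; s≤s; _≤ᵇ_; _≡ᵇ_)
import Data.Nat.Properties as ℕₚ
open import Data.Nat.ListAction using (sum)
open import Data.Nat.ListAction.Properties using (sum-++)
open import Data.Nat.Tactic.RingSolver using () renaming (solve-∀ to ℕ-solve-∀)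
open import Data.Integer as ℤ using (ℤ; +_; -_; ∣_∣)
  renaming (_+_ to _+ℤ_; _-_ to _-ℤ_; _*_ to _*ℤ_; _≤_ to _≤ℤ_; _⊔_ to _⊔ℤ_)
import Data.Integer.Properties as ℤₚ
open import Data.Integer.Tactic.RingSolver using (solve-∀)
open import Algebra.Properties.CommutativeSemigroup ℤₚ.+-commutativeSemigroup using (interchange)
open import Data.List as List using (List; []; _∷_; _++_; map; upTo; replicate; length)
import Data.List.Properties as Listₚ
open import Data.Vec as Vec using (Vec; []; _∷_; _∷ʳ_; toList)
import Data.Vec.Properties as Vecₚ
open import Data.Vec.Relation.Unary.All as All using (All; []; _∷_)
open import Data.Vec.Relation.Unary.Any as Any using (Any; here; there)
open import Data.List.Relation.Unary.Any using (here; there) renaming (Any to AnyL)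
import Data.List.Relation.Unary.Any.Properties as AnyLₚ
import Data.Vec.Relation.Unary.Any.Properties as Anyₚ
import Data.Vec.Relation.Unary.All.Properties as Allₚ
open import Function using (_∘_; id)
open import Function.Bundles using (_↔_; mk↔ₛ′; Inverse)
open import Function.Properties.Inverse using (↔-refl; ↔-sym; ↔-trans)
open import Data.Sum.Function.Propositional using (_⊎-↔_)
open import Data.Fin as Fin using (Fin)
import Data.Product.Function.Dependent.Propositional as Σₚ
open import Data.Fin.Permutation using (↔⇒≡)
open import Function.Related.Propositional as Related using ()
import Data.Fin.Properties as Finₚ
open import Relation.Binary.PropositionalEquality
open import Relation.Nullary using (Dec; yes; no; does; ¬_; Irrelevant)
open import Relation.Nullary.Decidable using (_×-dec_; ¬?)
import Relation.Binary.Reasoning.Setoid as SetoidReasoning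

module ≈S-Reasoning = SetoidReasoning (ℕ →-setoid ℤ)

sumℤ-map-+ : ∀ {A : Set} (h g : A → ℤ) xs →
  sumℤ (map (λ x → h x +ℤ g x) xs) ≡ sumℤ (map h xs) +ℤ sumℤ (map g xs)
sumℤ-map-+ h g [] = refl
sumℤ-map-+ h g (x ∷ xs) =
  trans (cong (h x +ℤ g x +ℤ_) (sumℤ-map-+ h g xs)) (interchange (h x) (g x) _ _)

sumℤ-map-neg : ∀ {A : Set} (h : A → ℤ) xs → sumℤ (map (λ x → - h x) xs) ≡ - sumℤ (map h xs)
sumℤ-map-neg h [] = refl
sumℤ-map-neg h (x ∷ xs) =
  trans (cong (- h x +ℤ_) (sumℤ-map-neg h xs)) (sym (ℤₚ.neg-distrib-+ (h x) _))

sumℤ-map-0 : ∀ {A : Set} (h : A → ℤ) xs → (∀ x → h x ≡ + 0) → sumℤ (map h xs) ≡ + 0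
sumℤ-map-0 h [] h≡0 = refl
sumℤ-map-0 h (x ∷ xs) h≡0 = cong₂ _+ℤ_ (h≡0 x) (sumℤ-map-0 h xs h≡0)

map-upTo-suc : ∀ {A : Set} (h : ℕ → A) n → map h (upTo (suc n)) ≡ h 0 ∷ map (h ∘ suc) (upTo n)
map-upTo-suc h n =
  cong (h 0 ∷_) (trans (Listₚ.map-applyUpTo suc h n) (sym (Listₚ.map-applyUpTo id (h ∘ suc) n)))

sumUpTo : ℕ → (ℕ → ℤ) → ℤ
sumUpTo n h = sumℤ (map h (upTo n))

sumUpTo-suc : ∀ n h → sumUpTo (suc n) h ≡ h 0 +ℤ sumUpTo n (h ∘ suc)
sumUpTo-suc n h = cong sumℤ (map-upTo-suc h n)

sumUpTo-sucʳ : ∀ n h → sumUpTo (suc n) h ≡ sumUpTo n h +ℤ h n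
sumUpTo-sucʳ zero h = trans (ℤₚ.+-identityʳ (h 0)) (sym (ℤₚ.+-identityˡ (h 0)))
sumUpTo-sucʳ (suc n) h = begin
  sumUpTo (suc (suc n)) h                   ≡⟨ sumUpTo-suc (suc n) h ⟩
  h 0 +ℤ sumUpTo (suc n) (h ∘ suc)          ≡⟨ cong (h 0 +ℤ_) (sumUpTo-sucʳ n (h ∘ suc)) ⟩
  h 0 +ℤ (sumUpTo n (h ∘ suc) +ℤ h (suc n)) ≡⟨ sym (ℤₚ.+-assoc (h 0) _ _) ⟩
  h 0 +ℤ sumUpTo n (h ∘ suc) +ℤ h (suc n)   ≡⟨ cong (_+ℤ h (suc n)) (sym (sumUpTo-suc n h)) ⟩
  sumUpTo (suc n) h +ℤ h (suc n)            ∎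
  where open ≡-Reasoning

sumUpTo-cong : ∀ n {h g} → (∀ i → i < n → h i ≡ g i) → sumUpTo n h ≡ sumUpTo n g
sumUpTo-cong zero h≡g = refl
sumUpTo-cong (suc n) {h} {g} h≡g = begin
  sumUpTo (suc n) h             ≡⟨ sumUpTo-suc n h ⟩
  h 0 +ℤ sumUpTo n (h ∘ suc)    ≡⟨ cong₂ _+ℤ_ (h≡g 0 (s≤s z≤n)) (sumUpTo-cong n (λ i i<n → h≡g (suc i) (s≤s i<n))) ⟩
  g 0 +ℤ sumUpTo n (g ∘ suc)    ≡⟨ sumUpTo-suc n g ⟨
  sumUpTo (suc n) g             ∎
  where open ≡-Reasoning

sumUpTo-reverse : ∀ n h → sumUpTo n h ≡ sumUpTo n (λ i → h (n ∸ suc i))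
sumUpTo-reverse zero h = refl
sumUpTo-reverse (suc n) h = begin
  sumUpTo (suc n) h                                    ≡⟨ sumUpTo-suc n h ⟩
  h 0 +ℤ sumUpTo n (h ∘ suc)                           ≡⟨ cong (h 0 +ℤ_) (sumUpTo-reverse n (h ∘ suc)) ⟩
  h 0 +ℤ sumUpTo n (λ i → h (suc (n ∸ suc i)))         ≡⟨ ℤₚ.+-comm (h 0) _ ⟩
  sumUpTo n (λ i → h (suc (n ∸ suc i))) +ℤ h 0         ≡⟨ cong₂ _+ℤ_ (sumUpTo-cong n (λ i i<n → cong h (sym (ℕₚ.+-∸-assoc 1 i<n))))
                                                                     (cong h (sym (ℕₚ.n∸n≡0 n))) ⟩
  sumUpTo n (λ i → h (suc n ∸ suc i)) +ℤ h (n ∸ n)     ≡⟨ sumUpTo-sucʳ n _ ⟨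
  sumUpTo (suc n) (λ i → h (suc n ∸ suc i))            ∎
  where open ≡-Reasoning

-- Multiplication by q^k of a coefficient sequence whose zero is o.
shift : ∀ {A : Set} → A → ℕ → (ℕ → A) → ℕ → A
shift o zero F m = F m
shift o (suc k) F zero = o
shift o (suc k) F (suc m) = shift o k F m

shift-cong : ∀ {A : Set} {o : A} k {F G : ℕ → A} → (∀ m → F m ≡ G m) → ∀ m → shift o k F m ≡ shift o k G m
shift-cong zero F≡G m = F≡G m
shift-cong (suc k) F≡G zero = refl
shift-cong (suc k) F≡G (suc m) = shift-cong k F≡G m

shift-map : ∀ {A B : Set} (f : A → B) {o} k F m → f (shift o k F m) ≡ shift (f o) k (f ∘ F) m
shift-map f zero F m = refl
shift-map f (suc k) F zero = refl
shift-map f (suc k) F (suc m) = shift-map f k F m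

shift-zipWith : ∀ {A : Set} (f : A → A → A) {o} k F G m →
  f (shift o k F m) (shift o k G m) ≡ shift (f o o) k (λ x → f (F x) (G x)) m
shift-zipWith f zero F G m = refl
shift-zipWith f (suc k) F G zero = refl
shift-zipWith f (suc k) F G (suc m) = shift-zipWith f k F G m

monomial-suc : ∀ k m → monomial (suc k) (suc m) ≡ monomial k m
monomial-suc k m with suc k ℕ.≟ suc m | k ℕ.≟ m
... | yes _ | yes _ = refl
... | no _  | no _  = refl
... | yes p | no ¬q = ⊥-elim (¬q (ℕₚ.suc-injective p))
... | no ¬p | yes q = ⊥-elim (¬p (cong suc q))

shift-monomial : ∀ k j → shift (+ 0) k (monomial j) ≈S monomial (k + j)
shift-monomial zero j m = refl
shift-monomial (suc k) j zero = refl
shift-monomial (suc k) j (suc m) = trans (shift-monomial k j m) (sym (monomial-suc (k + j) m))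

⊛-cong : ∀ {F F′ G G′} → F ≈S F′ → G ≈S G′ → (F ⊛ G) ≈S (F′ ⊛ G′)
⊛-cong F≈F′ G≈G′ m = sumUpTo-cong (suc m) (λ i _ → cong₂ _*ℤ_ (F≈F′ i) (G≈G′ (m ∸ i)))

⊛-comm : ∀ F G → (F ⊛ G) ≈S (G ⊛ F)
⊛-comm F G m = trans (sumUpTo-reverse (suc m) (λ i → F i *ℤ G (m ∸ i))) (sumUpTo-cong (suc m) λ i i≤m →
  trans (cong (λ j → F (m ∸ i) *ℤ G j) (ℕₚ.m∸[m∸n]≡n (ℕₚ.≤-pred i≤m))) (ℤₚ.*-comm (F (m ∸ i)) (G i)))

⊛-distribˡ-⊕ : ∀ F G H → (F ⊛ (G ⊕ H)) ≈S ((F ⊛ G) ⊕ (F ⊛ H))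
⊛-distribˡ-⊕ F G H m =
  trans (cong sumℤ (Listₚ.map-cong (λ i → ℤₚ.*-distribˡ-+ (F i) (G (m ∸ i)) (H (m ∸ i))) (upTo (suc m))))
        (sumℤ-map-+ (λ i → F i *ℤ G (m ∸ i)) (λ i → F i *ℤ H (m ∸ i)) (upTo (suc m)))

⊛-distribˡ-⊖ : ∀ F G H → (F ⊛ (G ⊖ H)) ≈S ((F ⊛ G) ⊖ (F ⊛ H))
⊛-distribˡ-⊖ F G H m = trans (⊛-distribˡ-⊕ F G (λ k → - H k) m) (cong ((F ⊛ G) m +ℤ_) ⊛-neg)
  where
  ⊛-neg : (F ⊛ (λ k → - H k)) m ≡ - (F ⊛ H) m
  ⊛-neg = trans (cong sumℤ (Listₚ.map-cong (λ i → sym (ℤₚ.neg-distribʳ-* (F i) (H (m ∸ i)))) (upTo (suc m))))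
                (sumℤ-map-neg (λ i → F i *ℤ H (m ∸ i)) (upTo (suc m)))

⊛-distribʳ-⊖ : ∀ F G H → ((F ⊖ G) ⊛ H) ≈S ((F ⊛ H) ⊖ (G ⊛ H))
⊛-distribʳ-⊖ F G H m = trans (⊛-comm (F ⊖ G) H m)
  (trans (⊛-distribˡ-⊖ H F G m) (cong₂ _-ℤ_ (⊛-comm H F m) (⊛-comm H G m)))

⊛-distribˡ-sumS : ∀ {A : Set} F (G : A → Series) xs → (F ⊛ sumS (map G xs)) ≈S sumS (map (λ x → F ⊛ G x) xs)
⊛-distribˡ-sumS F G [] m = sumℤ-map-0 (λ i → F i *ℤ + 0) (upTo (suc m)) (λ i → ℤₚ.*-zeroʳ (F i))
⊛-distribˡ-sumS F G (x ∷ xs) m =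
  trans (⊛-distribˡ-⊕ F (G x) (sumS (map G xs)) m) (cong ((F ⊛ G x) m +ℤ_) (⊛-distribˡ-sumS F G xs m))

monomial-⊛ : ∀ k G → (monomial k ⊛ G) ≈S shift (+ 0) k G
monomial-⊛ zero G zero = trans (ℤₚ.+-identityʳ _) (ℤₚ.*-identityˡ (G 0))
monomial-⊛ zero G (suc m) = begin
  (monomial 0 ⊛ G) (suc m)
    ≡⟨ sumUpTo-suc (suc m) (λ i → monomial 0 i *ℤ G (suc m ∸ i)) ⟩
  monomial 0 0 *ℤ G (suc m) +ℤ sumUpTo (suc m) (λ i → + 0 *ℤ G (m ∸ i))
    ≡⟨ cong₂ _+ℤ_ (ℤₚ.*-identityˡ (G (suc m))) (sumℤ-map-0 _ (upTo (suc m)) (λ i → ℤₚ.*-zeroˡ (G (m ∸ i)))) ⟩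
  G (suc m) +ℤ + 0
    ≡⟨ ℤₚ.+-identityʳ _ ⟩
  G (suc m) ∎
  where open ≡-Reasoning
monomial-⊛ (suc k) G zero = refl
monomial-⊛ (suc k) G (suc m) = begin
  (monomial (suc k) ⊛ G) (suc m)
    ≡⟨ sumUpTo-suc (suc m) (λ i → monomial (suc k) i *ℤ G (suc m ∸ i)) ⟩
  + 0 +ℤ sumUpTo (suc m) (λ i → monomial (suc k) (suc i) *ℤ G (m ∸ i))
    ≡⟨ ℤₚ.+-identityˡ _ ⟩
  sumUpTo (suc m) (λ i → monomial (suc k) (suc i) *ℤ G (m ∸ i))
    ≡⟨ sumUpTo-cong (suc m) (λ i _ → cong (_*ℤ G (m ∸ i)) (monomial-suc k i)) ⟩
  (monomial k ⊛ G) m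
    ≡⟨ monomial-⊛ k G m ⟩
  shift (+ 0) k G m ∎
  where open ≡-Reasoning

shift-⊛ : ∀ k G F → (shift (+ 0) k G ⊛ F) ≈S shift (+ 0) k (G ⊛ F)
shift-⊛ zero G F m = refl
shift-⊛ (suc k) G F zero = refl
shift-⊛ (suc k) G F (suc m) =
  trans (sumUpTo-suc (suc m) (λ i → shift (+ 0) (suc k) G i *ℤ F (suc m ∸ i)))
        (trans (ℤₚ.+-identityˡ _) (shift-⊛ k G F m))

⊛-shift : ∀ k G F → (G ⊛ shift (+ 0) k F) ≈S shift (+ 0) k (G ⊛ F)
⊛-shift k G F m =
  trans (⊛-comm G (shift (+ 0) k F) m) (trans (shift-⊛ k F G m) (shift-cong k (⊛-comm F G) m))

^S-cong : ∀ {F G} n → F ≈S G → (F ^S n) ≈S (G ^S n)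
^S-cong zero F≈G m = refl
^S-cong (suc n) F≈G = ⊛-cong F≈G (^S-cong n F≈G)

monomial-^S : ∀ a n → (monomial a ^S n) ≈S monomial (n * a)
monomial-^S a zero m = refl
monomial-^S a (suc n) m = begin
  (monomial a ⊛ (monomial a ^S n)) m   ≡⟨ ⊛-cong {monomial a} (λ _ → refl) (monomial-^S a n) m ⟩
  (monomial a ⊛ monomial (n * a)) m    ≡⟨ monomial-⊛ a _ m ⟩
  shift (+ 0) a (monomial (n * a)) m   ≡⟨ shift-monomial a (n * a) m ⟩
  monomial (a + n * a) m               ∎
  where open ≡-Reasoning

qS-^S : ∀ r → (qS ^S r) ≈S monomial r
qS-^S r m = trans (monomial-^S 1 r m) (cong (λ k → monomial k m) (ℕₚ.*-identityʳ r))

⊕-cong : ∀ {F F′ G G′} → F ≈S F′ → G ≈S G′ → (F ⊕ G) ≈S (F′ ⊕ G′)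
⊕-cong F≈F′ G≈G′ m = cong₂ _+ℤ_ (F≈F′ m) (G≈G′ m)

⊖-cong : ∀ {F F′ G G′} → F ≈S F′ → G ≈S G′ → (F ⊖ G) ≈S (F′ ⊖ G′)
⊖-cong F≈F′ G≈G′ m = cong₂ _-ℤ_ (F≈F′ m) (G≈G′ m)

sumS-cong : ∀ {A : Set} (F G : A → Series) xs → (∀ x → F x ≈S G x) → sumS (map F xs) ≈S sumS (map G xs)
sumS-cong F G [] F≈G m = refl
sumS-cong F G (x ∷ xs) F≈G m = cong₂ _+ℤ_ (F≈G x m) (sumS-cong F G xs F≈G m)

sumS-fromℕcoeffs : ∀ {A : Set} (f : A → ℕ → ℕ) xs → sumS (map (fromℕcoeffs ∘ f) xs) ≈S fromℕcoeffs (λ m → sum (map (λ x → f x m) xs))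
sumS-fromℕcoeffs f [] m = refl
sumS-fromℕcoeffs f (x ∷ xs) m = trans (cong (+ f x m +ℤ_) (sumS-fromℕcoeffs f xs m)) (sym (ℤₚ.pos-+ (f x m) _))

⊛-shift-monomial : ∀ k G F → (G ⊛ shift (+ 0) k F) ≈S (monomial k ⊛ (G ⊛ F))
⊛-shift-monomial k G F m = trans (⊛-shift k G F m) (sym (monomial-⊛ k (G ⊛ F) m))

pochR-suc : ∀ r n → pochR r (suc n) ≈S (pochR r n ⊖ shift (+ 0) (suc n * r) (pochR r n))
pochR-suc r n = begin
  P ⊛ (one ⊖ ((qS ^S r) ⊛ ((qS ^S r) ^S n)))
    ≈⟨ ⊛-distribˡ-⊖ P one _ ⟩
  (P ⊛ one) ⊖ (P ⊛ ((qS ^S r) ⊛ ((qS ^S r) ^S n)))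
    ≈⟨ ⊖-cong P⊛one≈P (⊛-cong {P} (λ _ → refl) qʳ⁽ⁿ⁺¹⁾) ⟩
  P ⊖ (P ⊛ monomial (suc n * r))
    ≈⟨ ⊖-cong {P} (λ _ → refl) (λ m → trans (⊛-comm P (monomial (suc n * r)) m) (monomial-⊛ (suc n * r) P m)) ⟩
  P ⊖ shift (+ 0) (suc n * r) P ∎
  where
  open ≈S-Reasoning
  P = pochR r n
  P⊛one≈P : (P ⊛ one) ≈S P
  P⊛one≈P m = trans (⊛-comm P one m) (monomial-⊛ 0 P m)
  qʳ⁽ⁿ⁺¹⁾ : ((qS ^S r) ⊛ ((qS ^S r) ^S n)) ≈S monomial (suc n * r)
  qʳ⁽ⁿ⁺¹⁾ m = trans (⊛-cong (qS-^S r) (^S-cong n (qS-^S r)) m) (monomial-^S r (suc n) m)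

cancel-middle : ∀ a b c → (a +ℤ b +ℤ c) -ℤ b ≡ a +ℤ c
cancel-middle = solve-∀

shifted-difference : ∀ R (f< f≤ f₌ s : ℕ → ℕ) →
  (∀ m → f≤ m ≡ f< m + f₌ m) → (∀ m → f₌ m ≡ shift 0 R f≤ m + s m) →
  (fromℕcoeffs f₌ ⊖ shift (+ 0) R (fromℕcoeffs f₌)) ≈S (shift (+ 0) R (fromℕcoeffs f<) ⊕ fromℕcoeffs s)
shifted-difference R f< f≤ f₌ s f≤≡ f₌≡ m = begin
  + f₌ m -ℤ shift (+ 0) R (fromℕcoeffs f₌) m
    ≡⟨ cong₂ _-ℤ_ (cong +_ (f₌≡ m)) (sym (shift-map +_ R f₌ m)) ⟩
  + (shift 0 R f≤ m + s m) -ℤ + shift 0 R f₌ m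
    ≡⟨ cong (λ x → + (x + s m) -ℤ + shift 0 R f₌ m) (trans (shift-cong R f≤≡ m) (sym (shift-zipWith _+_ R f< f₌ m))) ⟩
  + (shift 0 R f< m + shift 0 R f₌ m + s m) -ℤ + shift 0 R f₌ m
    ≡⟨ cong (_-ℤ + shift 0 R f₌ m) (trans (ℤₚ.pos-+ _ (s m)) (cong (_+ℤ + s m) (ℤₚ.pos-+ (shift 0 R f< m) _))) ⟩
  (+ shift 0 R f< m +ℤ + shift 0 R f₌ m +ℤ + s m) -ℤ + shift 0 R f₌ m
    ≡⟨ cancel-middle (+ shift 0 R f< m) (+ shift 0 R f₌ m) (+ s m) ⟩
  + shift 0 R f< m +ℤ + s m
    ≡⟨ cong (_+ℤ + s m) (shift-map +_ R f< m) ⟩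
  shift (+ 0) R (fromℕcoeffs f<) m +ℤ + s m ∎
  where open ≡-Reasoning

exact-recurrence : ∀ {A : Set} r n (f< f≤ f₌ : ℕ → ℕ) (fd : A → ℕ → ℕ) (D : A → ℕ) (ds : List A) →
  (∀ m → f≤ m ≡ f< m + f₌ m) →
  (∀ m → f₌ m ≡ shift 0 (suc n * r) f≤ m + sum (map (λ d → shift 0 (D d) (fd d) m) ds)) →
  (pochR r (suc n) ⊛ fromℕcoeffs f₌) ≈S
    ((monomial (suc n * r) ⊛ (pochR r n ⊛ fromℕcoeffs f<)) ⊕
     sumS (map (λ d → monomial (D d) ⊛ (pochR r n ⊛ fromℕcoeffs (fd d))) ds))
exact-recurrence r n f< f≤ f₌ fd D ds f≤≡ f₌≡ = begin
  pochR r (suc n) ⊛ F₌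
    ≈⟨ ⊛-cong (pochR-suc r n) (λ _ → refl) ⟩
  (P ⊖ shift (+ 0) R P) ⊛ F₌
    ≈⟨ ⊛-distribʳ-⊖ P (shift (+ 0) R P) F₌ ⟩
  (P ⊛ F₌) ⊖ (shift (+ 0) R P ⊛ F₌)
    ≈⟨ ⊖-cong {P ⊛ F₌} (λ _ → refl) (λ m → trans (shift-⊛ R P F₌ m) (sym (⊛-shift R P F₌ m))) ⟩
  (P ⊛ F₌) ⊖ (P ⊛ shift (+ 0) R F₌)
    ≈⟨ ⊛-distribˡ-⊖ P F₌ (shift (+ 0) R F₌) ⟨
  P ⊛ (F₌ ⊖ shift (+ 0) R F₌)
    ≈⟨ ⊛-cong {P} (λ _ → refl) (shifted-difference R f< f≤ f₌ others f≤≡ f₌≡) ⟩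
  P ⊛ (shift (+ 0) R (fromℕcoeffs f<) ⊕ fromℕcoeffs others)
    ≈⟨ ⊛-cong {P} (λ _ → refl) (⊕-cong {shift (+ 0) R _} (λ _ → refl) others≈) ⟨
  P ⊛ (shift (+ 0) R (fromℕcoeffs f<) ⊕ sumS (map (λ d → shift (+ 0) (D d) (fromℕcoeffs (fd d))) ds))
    ≈⟨ ⊛-distribˡ-⊕ P _ _ ⟩
  (P ⊛ shift (+ 0) R (fromℕcoeffs f<)) ⊕ (P ⊛ sumS (map (λ d → shift (+ 0) (D d) (fromℕcoeffs (fd d))) ds))
    ≈⟨ ⊕-cong (⊛-shift-monomial R P (fromℕcoeffs f<))
              (λ m → trans (⊛-distribˡ-sumS P _ ds m)
                           (sumS-cong _ _ ds (λ d → ⊛-shift-monomial (D d) P (fromℕcoeffs (fd d))) m)) ⟩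
  (monomial R ⊛ (P ⊛ fromℕcoeffs f<)) ⊕ sumS (map (λ d → monomial (D d) ⊛ (P ⊛ fromℕcoeffs (fd d))) ds) ∎
  where
  open ≈S-Reasoning
  R = suc n * r
  P = pochR r n
  F₌ = fromℕcoeffs f₌
  others : ℕ → ℕ
  others m = sum (map (λ d → shift 0 (D d) (fd d) m) ds)
  others≈ : sumS (map (λ d → shift (+ 0) (D d) (fromℕcoeffs (fd d))) ds) ≈S fromℕcoeffs others
  others≈ m = trans (sumS-cong _ (λ d → fromℕcoeffs (shift 0 (D d) (fd d))) ds (λ d k → sym (shift-map +_ (D d) (fd d) k)) m)
                    (sumS-fromℕcoeffs (λ d → shift 0 (D d) (fd d)) ds m)

module _ {A : Set} where

  rotV : ∀ {k} → Vec A (suc k) → Vec A (suc k)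
  rotV (x ∷ xs) = xs ∷ʳ x

  unrotV : ∀ {k} → Vec A (suc k) → Vec A (suc k)
  unrotV v = Vec.last v ∷ Vec.init v

  toList-rotV : ∀ {k} (v : Vec A (suc k)) → toList (rotV v) ≡ rot (toList v)
  toList-rotV (x ∷ xs) = Vecₚ.toList-∷ʳ x xs

  rotV-unrotV : ∀ {k} (v : Vec A (suc k)) → rotV (unrotV v) ≡ v
  rotV-unrotV v = sym (proj₂ (proj₂ (Vec.initLast v)))

  unrotV-rotV : ∀ {k} (v : Vec A (suc k)) → unrotV (rotV v) ≡ v
  unrotV-rotV (x ∷ xs) = cong₂ _∷_ (Vecₚ.last-∷ʳ x xs) (Vecₚ.init-∷ʳ x xs)

  rotV-replicate : ∀ k (x : A) → rotV (Vec.replicate (suc k) x) ≡ Vec.replicate (suc k) x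
  rotV-replicate k x = go k
    where
    go : ∀ k → Vec.replicate k x ∷ʳ x ≡ x ∷ Vec.replicate k x
    go zero = refl
    go (suc k) = cong (x ∷_) (go k)

  All-∷ʳ : ∀ {P : A → Set} {k} {xs : Vec A k} {x} → All P xs → P x → All P (xs ∷ʳ x)
  All-∷ʳ [] px = px ∷ []
  All-∷ʳ (py ∷ pxs) px = py ∷ All-∷ʳ pxs px

  All-rotV : ∀ {P : A → Set} {k} {v : Vec A (suc k)} → All P v → All P (rotV v)
  All-rotV (px ∷ pxs) = All-∷ʳ pxs px

  Any-last : ∀ {P : A → Set} {k} (v : Vec A (suc k)) → P (Vec.last v) → Any P v
  Any-last (x ∷ []) p = here p
  Any-last (x ∷ y ∷ v) p = there (Any-last (y ∷ v) p)

rotV-zipWith : ∀ {A B C : Set} (f : A → B → C) {k} (as : Vec A (suc k)) bs →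
  rotV (Vec.zipWith f as bs) ≡ Vec.zipWith f (rotV as) (rotV bs)
rotV-zipWith f (a ∷ as) (b ∷ bs) = go as bs
  where
  go : ∀ {k} (as : Vec _ k) bs → Vec.zipWith f as bs ∷ʳ f a b ≡ Vec.zipWith f (as ∷ʳ a) (bs ∷ʳ b)
  go [] [] = refl
  go (x ∷ xs) (y ∷ ys) = cong (f x y ∷_) (go xs ys)

module _ {A B C D : Set} (R : A → B → C → D → Set) where

  Pointwise₄ : ∀ {k} → Vec A k → Vec B k → Vec C k → Vec D k → Set
  Pointwise₄ [] [] [] [] = ⊤
  Pointwise₄ (a ∷ as) (b ∷ bs) (c ∷ cs) (d ∷ ds) = R a b c d × Pointwise₄ as bs cs ds

  Pointwise₄-∷ʳ : ∀ {k} (as : Vec A k) bs cs ds {a b c d} →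
    Pointwise₄ as bs cs ds → R a b c d → Pointwise₄ (as ∷ʳ a) (bs ∷ʳ b) (cs ∷ʳ c) (ds ∷ʳ d)
  Pointwise₄-∷ʳ [] [] [] [] _ r = r , tt
  Pointwise₄-∷ʳ (_ ∷ as) (_ ∷ bs) (_ ∷ cs) (_ ∷ ds) (r′ , rs) r = r′ , Pointwise₄-∷ʳ as bs cs ds rs r

  Pointwise₄-rotV : ∀ {k} (as : Vec A (suc k)) bs cs ds →
    Pointwise₄ as bs cs ds → Pointwise₄ (rotV as) (rotV bs) (rotV cs) (rotV ds)
  Pointwise₄-rotV (_ ∷ as) (_ ∷ bs) (_ ∷ cs) (_ ∷ ds) (r , rs) = Pointwise₄-∷ʳ as bs cs ds rs r

  Pointwise₄-unrotV : ∀ {k} (as : Vec A (suc k)) bs cs ds →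
    Pointwise₄ as bs cs ds → Pointwise₄ (unrotV as) (unrotV bs) (unrotV cs) (unrotV ds)
  Pointwise₄-unrotV as bs cs ds rs = last as bs cs ds rs , init as bs cs ds rs
    where
    last : ∀ {k} (as : Vec A (suc k)) bs cs ds → Pointwise₄ as bs cs ds →
      R (Vec.last as) (Vec.last bs) (Vec.last cs) (Vec.last ds)
    last (_ ∷ []) (_ ∷ []) (_ ∷ []) (_ ∷ []) (r , _) = r
    last (_ ∷ a ∷ as) (_ ∷ b ∷ bs) (_ ∷ c ∷ cs) (_ ∷ d ∷ ds) (_ , rs) = last (a ∷ as) (b ∷ bs) (c ∷ cs) (d ∷ ds) rs
    init : ∀ {k} (as : Vec A (suc k)) bs cs ds → Pointwise₄ as bs cs ds →
      Pointwise₄ (Vec.init as) (Vec.init bs) (Vec.init cs) (Vec.init ds)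
    init (_ ∷ []) (_ ∷ []) (_ ∷ []) (_ ∷ []) _ = tt
    init (_ ∷ a ∷ as) (_ ∷ b ∷ bs) (_ ∷ c ∷ cs) (_ ∷ d ∷ ds) (r , rs) = r , init (a ∷ as) (b ∷ bs) (c ∷ cs) (d ∷ ds) rs

∧-split : ∀ {a b} → T (a ∧ b) → T a × T b
∧-split {true} {true} _ = tt , tt

∧-join : ∀ {a b} → T a → T b → T (a ∧ b)
∧-join {true} {true} _ _ = tt

≡ᵇ-refl : ∀ n → (n ≡ᵇ n) ≡ true
≡ᵇ-refl zero = refl
≡ᵇ-refl (suc n) = ≡ᵇ-refl n

≡ᵇ-suc-> : ∀ {y n} → y ≤ n → (y ≡ᵇ suc n) ≡ false
≡ᵇ-suc-> {y} {n} y≤n with y ≡ᵇ suc n in eq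
... | false = refl
... | true = ⊥-elim (ℕₚ.<-irrefl (ℕₚ.≡ᵇ⇒≡ y (suc n) (subst T (sym eq) tt)) (s≤s y≤n))

AtMost : ℕ → List ℕ → Set
AtMost K xs = ∀ j → nth0 xs j ≤ K

pad : ℕ → ℕ → List ℕ → List ℕ
pad N m xs = replicate m N ++ xs

nth0-≥length : ∀ xs j → length xs ≤ j → nth0 xs j ≡ 0
nth0-≥length [] j _ = refl
nth0-≥length (x ∷ xs) (suc j) (s≤s l≤j) = nth0-≥length xs j l≤j

nth0-pad-< : ∀ N m xs j → j < m → nth0 (pad N m xs) j ≡ N
nth0-pad-< N (suc m) xs zero _ = refl
nth0-pad-< N (suc m) xs (suc j) (s≤s j<m) = nth0-pad-< N m xs j j<m

nth0-pad-+ : ∀ N m xs j → nth0 (pad N m xs) (m + j) ≡ nth0 xs j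
nth0-pad-+ N zero xs j = refl
nth0-pad-+ N (suc m) xs j = nth0-pad-+ N m xs j

AtMost-pad : ∀ N m xs → AtMost N xs → AtMost N (pad N m xs)
AtMost-pad N zero xs xs≤N j = xs≤N j
AtMost-pad N (suc m) xs xs≤N zero = ℕₚ.≤-refl
AtMost-pad N (suc m) xs xs≤N (suc j) = AtMost-pad N m xs xs≤N j

AtMost-unpad : ∀ {K} N m xs → AtMost K (pad N m xs) → AtMost K xs
AtMost-unpad N m xs ≤K j = subst (_≤ _) (nth0-pad-+ N m xs j) (≤K (m + j))

all-upTo⁻ : ∀ (p : ℕ → Bool) (f : ℕ → ℕ) n → T (List.all p (map f (upTo n))) → ∀ j → j < n → T (p (f j))
all-upTo⁻ p f (suc n) t j j<n = go j j<n (∧-split {p (f 0)} (subst (T ∘ List.all p) (map-upTo-suc f n) t))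
  where
  go : ∀ j → j < suc n → T (p (f 0)) × T (List.all p (map (f ∘ suc) (upTo n))) → T (p (f j))
  go zero _ (t₀ , _) = t₀
  go (suc j) (s≤s j<n) (_ , t₁) = all-upTo⁻ p (f ∘ suc) n t₁ j j<n

all-upTo⁺ : ∀ (p : ℕ → Bool) (f : ℕ → ℕ) n → (∀ j → j < n → T (p (f j))) → T (List.all p (map f (upTo n)))
all-upTo⁺ p f zero _ = tt
all-upTo⁺ p f (suc n) h = subst (T ∘ List.all p) (sym (map-upTo-suc f n))
  (∧-join {p (f 0)} (h 0 (s≤s z≤n)) (all-upTo⁺ p (f ∘ suc) n (λ j j<n → h (suc j) (s≤s j<n))))

Dominates : ℕ → List ℕ → List ℕ → Set
Dominates k a b = ∀ j → nth0 b (j + k) ≤ nth0 a j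

dom⇒Dominates : ∀ k a b → T (dom k a b) → Dominates k a b
dom⇒Dominates k a b t j with j ℕₚ.<? length b
... | yes j<l = ℕₚ.≤ᵇ⇒≤ _ _ (all-upTo⁻ (λ j → part b (j + k) ≤ᵇ part a j) suc (length b) t j j<l)
... | no j≮l = subst (_≤ nth0 a j) (sym (nth0-≥length b (j + k) (ℕₚ.≤-trans (ℕₚ.≮⇒≥ j≮l) (ℕₚ.m≤m+n j k)))) z≤n

Dominates⇒dom : ∀ k a b → Dominates k a b → T (dom k a b)
Dominates⇒dom k a b a≥b = all-upTo⁺ (λ j → part b (j + k) ≤ᵇ part a j) suc (length b) (λ j _ → ℕₚ.≤⇒≤ᵇ (a≥b j))

realign : ∀ c d m m′ j → c + m ≡ d + m′ → m′ + (j + d) ≡ (m + j) + c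
realign c d m m′ j eq = begin
  m′ + (j + d)   ≡⟨ cong (λ x → m′ + x) (ℕₚ.+-comm j d) ⟩
  m′ + (d + j)   ≡⟨ sym (ℕₚ.+-assoc m′ d j) ⟩
  m′ + d + j     ≡⟨ cong (_+ j) (trans (ℕₚ.+-comm m′ d) (sym eq)) ⟩
  c + m + j      ≡⟨ ℕₚ.+-assoc c m j ⟩
  c + (m + j)    ≡⟨ ℕₚ.+-comm c (m + j) ⟩
  m + j + c      ∎
  where open ≡-Reasoning

-- Padding shifts the indices of a by m and those of b by m′, so the offset c becomes d.
Dominates-unpad : ∀ N {c d} m m′ a b → c + m ≡ d + m′ → Dominates c (pad N m a) (pad N m′ b) → Dominates d a b
Dominates-unpad N {c} {d} m m′ a b eq dom j = begin
  nth0 b (j + d)                     ≡⟨ nth0-pad-+ N m′ b (j + d) ⟨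
  nth0 (pad N m′ b) (m′ + (j + d))   ≡⟨ cong (nth0 (pad N m′ b)) (realign c d m m′ j eq) ⟩
  nth0 (pad N m′ b) ((m + j) + c)    ≤⟨ dom (m + j) ⟩
  nth0 (pad N m a) (m + j)           ≡⟨ nth0-pad-+ N m a j ⟩
  nth0 a j                           ∎
  where open ℕₚ.≤-Reasoning

Dominates-pad : ∀ N {c d} m m′ a b → c + m ≡ d + m′ → AtMost N b → Dominates d a b → Dominates c (pad N m a) (pad N m′ b)
Dominates-pad N {c} {d} m m′ a b eq b≤N dom j with j ℕₚ.<? m
... | yes j<m = subst (nth0 (pad N m′ b) (j + c) ≤_) (sym (nth0-pad-< N m a j j<m)) (AtMost-pad N m′ b b≤N (j + c))
... | no j≮m = subst (λ j → nth0 (pad N m′ b) (j + c) ≤ nth0 (pad N m a) j) (ℕₚ.m+[n∸m]≡n (ℕₚ.≮⇒≥ j≮m)) (begin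
  nth0 (pad N m′ b) ((m + i) + c)    ≡⟨ cong (nth0 (pad N m′ b)) (realign c d m m′ i eq) ⟨
  nth0 (pad N m′ b) (m′ + (i + d))   ≡⟨ nth0-pad-+ N m′ b (i + d) ⟩
  nth0 b (i + d)                     ≤⟨ dom i ⟩
  nth0 a i                           ≡⟨ nth0-pad-+ N m a i ⟨
  nth0 (pad N m a) (m + i)           ∎)
  where
  open ℕₚ.≤-Reasoning
  i = j ∸ m

Dominates-pad⇒≤ : ∀ N {c} m m′ a b → nth0 a 0 < N → Dominates c (pad N m a) (pad N m′ b) → m′ ≤ c + m
Dominates-pad⇒≤ N {c} m m′ a b a₀<N dom with m′ ℕₚ.≤? c + m
... | yes m′≤c+m = m′≤c+m
... | no m′≰c+m = ⊥-elim (ℕₚ.<⇒≱ a₀<N (begin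
  N                                  ≡⟨ nth0-pad-< N m′ b (m + c) (subst (_< m′) (ℕₚ.+-comm c m) (ℕₚ.≰⇒> m′≰c+m)) ⟨
  nth0 (pad N m′ b) (m + c)          ≡⟨ cong (λ x → nth0 (pad N m′ b) (x + c)) (ℕₚ.+-identityʳ m) ⟨
  nth0 (pad N m′ b) ((m + 0) + c)    ≤⟨ dom (m + 0) ⟩
  nth0 (pad N m a) (m + 0)           ≡⟨ nth0-pad-+ N m a 0 ⟩
  nth0 a 0                           ∎))
  where open ℕₚ.≤-Reasoning

headAtMost : ℕ → List ℕ → Bool
headAtMost x [] = true
headAtMost x (y ∷ _) = y ≤ᵇ x

decreasing-∷ : ∀ x xs → decreasing (x ∷ xs) ≡ headAtMost x xs ∧ decreasing xs
decreasing-∷ x [] = refl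
decreasing-∷ x (y ∷ ys) = refl

decreasing-∷⁻ : ∀ x xs → T (decreasing (x ∷ xs)) → T (headAtMost x xs) × T (decreasing xs)
decreasing-∷⁻ x xs t = ∧-split {headAtMost x xs} (subst T (decreasing-∷ x xs) t)

decreasing-∷⁺ : ∀ x xs → T (headAtMost x xs) → T (decreasing xs) → T (decreasing (x ∷ xs))
decreasing-∷⁺ x xs h d = subst T (sym (decreasing-∷ x xs)) (∧-join h d)

decreasing⇒AtMost : ∀ x xs → T (decreasing (x ∷ xs)) → AtMost x (x ∷ xs)
decreasing⇒AtMost x [] t zero = ℕₚ.≤-refl
decreasing⇒AtMost x [] t (suc j) = z≤n
decreasing⇒AtMost x (y ∷ ys) t zero = ℕₚ.≤-refl
decreasing⇒AtMost x (y ∷ ys) t (suc j) with decreasing-∷⁻ x (y ∷ ys) t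
... | y≤x , d = ℕₚ.≤-trans (decreasing⇒AtMost y ys d j) (ℕₚ.≤ᵇ⇒≤ y x y≤x)

positive-++ : ∀ xs ys → positive (xs ++ ys) ≡ positive xs ∧ positive ys
positive-++ [] ys = refl
positive-++ (x ∷ xs) ys = trans (cong ((1 ≤ᵇ x) ∧_) (positive-++ xs ys)) (sym (Boolₚ.∧-assoc (1 ≤ᵇ x) _ _))

positive-replicate : ∀ {N} m → 1 ≤ N → T (positive (replicate m N))
positive-replicate zero _ = tt
positive-replicate (suc m) 1≤N = ∧-join (ℕₚ.≤⇒≤ᵇ 1≤N) (positive-replicate m 1≤N)

decreasing-unpad : ∀ N m xs → T (decreasing (pad N m xs)) → T (decreasing xs)
decreasing-unpad N zero xs t = t
decreasing-unpad N (suc m) xs t = decreasing-unpad N m xs (proj₂ (decreasing-∷⁻ N (pad N m xs) t))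

decreasing-pad : ∀ N m xs → AtMost N xs → T (decreasing xs) → T (decreasing (pad N m xs))
decreasing-pad N zero xs xs≤N t = t
decreasing-pad N (suc m) xs xs≤N t = decreasing-∷⁺ N (pad N m xs) (head≤N m xs xs≤N) (decreasing-pad N m xs xs≤N t)
  where
  head≤N : ∀ m xs → AtMost N xs → T (headAtMost N (pad N m xs))
  head≤N (suc m) xs _ = ℕₚ.≤⇒≤ᵇ (ℕₚ.≤-refl {N})
  head≤N zero [] _ = tt
  head≤N zero (y ∷ ys) y≤N = ℕₚ.≤⇒≤ᵇ (y≤N 0)

isPartition-unpad : ∀ N m xs → T (isPartition (pad N m xs)) → T (isPartition xs)
isPartition-unpad N m xs t with ∧-split {positive (pad N m xs)} t
... | p , d = ∧-join (proj₂ (∧-split {positive (replicate m N)} (subst T (positive-++ (replicate m N) xs) p)))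
                     (decreasing-unpad N m xs d)

isPartition-pad : ∀ N m xs → 1 ≤ N → AtMost N xs → T (isPartition xs) → T (isPartition (pad N m xs))
isPartition-pad N m xs 1≤N xs≤N t with ∧-split {positive xs} t
... | p , d = ∧-join (subst T (sym (positive-++ (replicate m N) xs)) (∧-join (positive-replicate m 1≤N) p))
                     (decreasing-pad N m xs xs≤N d)

leading : ℕ → List ℕ → ℕ
leading N [] = 0
leading N (x ∷ xs) = if x ≡ᵇ N then suc (leading N xs) else 0

dropLeading : ℕ → List ℕ → List ℕ
dropLeading N [] = []
dropLeading N (x ∷ xs) = if x ≡ᵇ N then dropLeading N xs else x ∷ xs

pad-leading : ∀ N xs → pad N (leading N xs) (dropLeading N xs) ≡ xs
pad-leading N [] = refl
pad-leading N (x ∷ xs) with x ≡ᵇ N in eq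
... | true = cong₂ _∷_ (sym (ℕₚ.≡ᵇ⇒≡ x N (subst T (sym eq) tt))) (pad-leading N xs)
... | false = refl

leading-pad : ∀ n m xs → AtMost n xs → leading (suc n) (pad (suc n) m xs) ≡ m
leading-pad n zero [] _ = refl
leading-pad n zero (y ∷ ys) ≤n rewrite ≡ᵇ-suc-> (≤n 0) = refl
leading-pad n (suc m) xs ≤n rewrite ≡ᵇ-refl n = cong suc (leading-pad n m xs ≤n)

dropLeading-pad : ∀ n m xs → AtMost n xs → dropLeading (suc n) (pad (suc n) m xs) ≡ xs
dropLeading-pad n zero [] _ = refl
dropLeading-pad n zero (y ∷ ys) ≤n rewrite ≡ᵇ-suc-> (≤n 0) = refl
dropLeading-pad n (suc m) xs ≤n rewrite ≡ᵇ-refl n = dropLeading-pad n m xs ≤n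

AtMost-dropLeading : ∀ n xs → T (decreasing xs) → AtMost (suc n) xs → AtMost n (dropLeading (suc n) xs)
AtMost-dropLeading n [] t ≤N j = z≤n
AtMost-dropLeading n (x ∷ xs) t ≤N with x ≡ᵇ suc n in eq
... | true = AtMost-dropLeading n xs (proj₂ (decreasing-∷⁻ x xs t)) (≤N ∘ suc)
... | false = λ j → ℕₚ.≤-trans (decreasing⇒AtMost x xs t j) x≤n
  where
  x≤n : x ≤ n
  x≤n with ℕₚ.m≤n⇒m<n∨m≡n (≤N 0)
  ... | inj₁ (s≤s x≤n) = x≤n
  ... | inj₂ x≡N = ⊥-elim (subst T eq (ℕₚ.≡⇒≡ᵇ x (suc n) x≡N))

padAll : ∀ {k} → ℕ → Vec ℕ k → Vec (List ℕ) k → Vec (List ℕ) k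
padAll N ms μ = Vec.zipWith (pad N) ms μ

-- Consecutive components padded with p and m parts N satisfy the profile entry c
-- exactly when the unpadded components satisfy d.
Shifted : ℕ → ℕ → ℕ → ℕ → Set
Shifted c p m d = c + p ≡ d + m

-- The last argument is unused; it lets Fits be checked along the same Pointwise₄ as Shifted.
Fits : ℕ → ℕ → ℕ → ℕ → Set
Fits c p m _ = m ≤ c + p

pairsOK-unpad : ∀ N {k} (cs ps ms ds : Vec ℕ k) (as bs : Vec (List ℕ) k) → Pointwise₄ Shifted cs ps ms ds →
  T (pairsOK (toList (padAll N ps as)) (toList (padAll N ms bs)) (toList cs)) → T (pairsOK (toList as) (toList bs) (toList ds))
pairsOK-unpad N [] [] [] [] [] [] _ _ = tt
pairsOK-unpad N (c ∷ cs) (p ∷ ps) (m ∷ ms) (d ∷ ds) (a ∷ as) (b ∷ bs) (sh , shs) t with ∧-split {dom c (pad N p a) (pad N m b)} t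
... | t₁ , t₂ = ∧-join (Dominates⇒dom d a b (Dominates-unpad N p m a b sh (dom⇒Dominates c (pad N p a) (pad N m b) t₁)))
                       (pairsOK-unpad N cs ps ms ds as bs shs t₂)

pairsOK-pad : ∀ N {k} (cs ps ms ds : Vec ℕ k) (as bs : Vec (List ℕ) k) → Pointwise₄ Shifted cs ps ms ds → All (AtMost N) bs →
  T (pairsOK (toList as) (toList bs) (toList ds)) → T (pairsOK (toList (padAll N ps as)) (toList (padAll N ms bs)) (toList cs))
pairsOK-pad N [] [] [] [] [] [] _ _ _ = tt
pairsOK-pad N (c ∷ cs) (p ∷ ps) (m ∷ ms) (d ∷ ds) (a ∷ as) (b ∷ bs) (sh , shs) (b≤N ∷ bs≤N) t with ∧-split {dom d a b} t
... | t₁ , t₂ = ∧-join (Dominates⇒dom c (pad N p a) (pad N m b) (Dominates-pad N p m a b sh b≤N (dom⇒Dominates d a b t₁)))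
                       (pairsOK-pad N cs ps ms ds as bs shs bs≤N t₂)

pairsOK-pad⇒Fits : ∀ N {k} (cs ps ms : Vec ℕ k) (as bs : Vec (List ℕ) k) → All (λ a → nth0 a 0 < N) as →
  T (pairsOK (toList (padAll N ps as)) (toList (padAll N ms bs)) (toList cs)) → Pointwise₄ Fits cs ps ms cs
pairsOK-pad⇒Fits N [] [] [] [] [] _ _ = tt
pairsOK-pad⇒Fits N (c ∷ cs) (p ∷ ps) (m ∷ ms) (a ∷ as) (b ∷ bs) (a₀<N ∷ as₀<N) t with ∧-split {dom c (pad N p a) (pad N m b)} t
... | t₁ , t₂ = Dominates-pad⇒≤ N p m a b a₀<N (dom⇒Dominates c (pad N p a) (pad N m b) t₁) , pairsOK-pad⇒Fits N cs ps ms as bs as₀<N t₂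

allPartitions-unpad : ∀ N {k} (ms : Vec ℕ k) μ → T (List.all isPartition (toList (padAll N ms μ))) → T (List.all isPartition (toList μ))
allPartitions-unpad N [] [] _ = tt
allPartitions-unpad N (m ∷ ms) (x ∷ μ) t with ∧-split {isPartition (pad N m x)} t
... | t₁ , t₂ = ∧-join (isPartition-unpad N m x t₁) (allPartitions-unpad N ms μ t₂)

allPartitions-pad : ∀ N {k} (ms : Vec ℕ k) μ → 1 ≤ N → All (AtMost N) μ →
  T (List.all isPartition (toList μ)) → T (List.all isPartition (toList (padAll N ms μ)))
allPartitions-pad N [] [] _ _ _ = tt
allPartitions-pad N (m ∷ ms) (x ∷ μ) 1≤N (x≤N ∷ μ≤N) t with ∧-split {isPartition x} t
... | t₁ , t₂ = ∧-join (isPartition-pad N m x 1≤N x≤N t₁) (allPartitions-pad N ms μ 1≤N μ≤N t₂)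

allPartitions⇒decreasing : ∀ {k} (Λ : Vec (List ℕ) k) → T (List.all isPartition (toList Λ)) → All (T ∘ decreasing) Λ
allPartitions⇒decreasing [] _ = []
allPartitions⇒decreasing (x ∷ Λ) t with ∧-split {isPartition x} t
... | t₁ , t₂ = proj₂ (∧-split {positive x} t₁) ∷ allPartitions⇒decreasing Λ t₂

maxList : List ℕ → ℕ
maxList = List.foldr _⊔_ 0

nth0≤maxList : ∀ xs j → nth0 xs j ≤ maxList xs
nth0≤maxList [] j = z≤n
nth0≤maxList (x ∷ xs) zero = ℕₚ.m≤m⊔n x (maxList xs)
nth0≤maxList (x ∷ xs) (suc j) = ℕₚ.≤-trans (nth0≤maxList xs j) (ℕₚ.m≤n⊔m x (maxList xs))

maxList-≤ : ∀ {K} xs → AtMost K xs → maxList xs ≤ K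
maxList-≤ [] _ = z≤n
maxList-≤ (x ∷ xs) ≤K = ℕₚ.⊔-lub (≤K 0) (maxList-≤ xs (≤K ∘ suc))

maxList-++ : ∀ xs ys → maxList (xs ++ ys) ≡ maxList xs ⊔ maxList ys
maxList-++ [] ys = refl
maxList-++ (x ∷ xs) ys = trans (cong (x ⊔_) (maxList-++ xs ys)) (sym (ℕₚ.⊔-assoc x (maxList xs) (maxList ys)))

maxPart-≤ : ∀ {k} K (Λ : Vec (List ℕ) k) → All (AtMost K) Λ → maxPart Λ ≤ K
maxPart-≤ K [] _ = z≤n
maxPart-≤ K (x ∷ Λ) (x≤K ∷ Λ≤K) =
  subst (_≤ K) (sym (maxList-++ x (List.concat (toList Λ)))) (ℕₚ.⊔-lub (maxList-≤ x x≤K) (maxPart-≤ K Λ Λ≤K))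

≤-maxPart : ∀ {k} K (Λ : Vec (List ℕ) k) → maxPart Λ ≤ K → All (AtMost K) Λ
≤-maxPart K [] _ = []
≤-maxPart K (x ∷ Λ) max≤K =
  (λ j → ℕₚ.≤-trans (nth0≤maxList x j) (ℕₚ.≤-trans (ℕₚ.m≤m⊔n _ _) max≤K′)) ∷
  ≤-maxPart K Λ (ℕₚ.≤-trans (ℕₚ.m≤n⊔m (maxList x) _) max≤K′)
  where max≤K′ = subst (_≤ K) (maxList-++ x (List.concat (toList Λ))) max≤K

N≤maxPart-padAll : ∀ N {k} (ms : Vec ℕ k) μ → Any (1 ≤_) ms → N ≤ maxPart (padAll N ms μ)
N≤maxPart-padAll N (suc m ∷ ms) (x ∷ μ) (here _) =
  subst (N ≤_) (sym (maxList-++ (pad N (suc m) x) _)) (ℕₚ.≤-trans (ℕₚ.m≤m⊔n N _) (ℕₚ.m≤m⊔n _ _))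
N≤maxPart-padAll N (m ∷ ms) (x ∷ μ) (there some) =
  subst (N ≤_) (sym (maxList-++ (pad N m x) _)) (ℕₚ.≤-trans (N≤maxPart-padAll N ms μ some) (ℕₚ.m≤n⊔m _ _))

sum-replicate : ∀ m N → sum (replicate m N) ≡ m * N
sum-replicate zero N = refl
sum-replicate (suc m) N = cong (_+_ N) (sum-replicate m N)

size-padAll : ∀ N {k} (ms : Vec ℕ k) μ → size (padAll N ms μ) ≡ vsum ms * N + size μ
size-padAll N [] [] = refl
size-padAll N (m ∷ ms) (x ∷ μ) = begin
  sum (pad N m x ++ List.concat (toList (padAll N ms μ)))   ≡⟨ sum-++ (pad N m x) _ ⟩
  sum (pad N m x) + size (padAll N ms μ)                     ≡⟨ cong₂ _+_ (trans (sum-++ (replicate m N) x) (cong (_+ sum x) (sum-replicate m N)))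
                                                                          (size-padAll N ms μ) ⟩
  (m * N + sum x) + (vsum ms * N + size μ)                   ≡⟨ regroup m N (sum x) (vsum ms) (size μ) ⟩
  (m + vsum ms) * N + (sum x + size μ)                       ≡⟨ cong (_+_ ((m + vsum ms) * N)) (sym (sum-++ x (List.concat (toList μ)))) ⟩
  (m + vsum ms) * N + sum (x ++ List.concat (toList μ))      ∎
  where
  open ≡-Reasoning
  regroup : ∀ m N x v s → (m * N + x) + (v * N + s) ≡ (m + v) * N + (x + s)
  regroup = ℕ-solve-∀

differences : ∀ {k} → Vec ℕ k → Vec ℕ k → Vec ℤ k
differences c d = Vec.zipWith (λ x y → + x -ℤ + y) c d

toList-differences : ∀ {k} (c d : Vec ℕ k) → toList (differences c d) ≡ List.zipWith (λ x y → + x -ℤ + y) (toList c) (toList d)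
toList-differences [] [] = refl
toList-differences (x ∷ c) (y ∷ d) = cong (_ ∷_) (toList-differences c d)

suffixSums : ∀ {k} → Vec ℤ k → Vec ℤ k
suffixSums [] = []
suffixSums (x ∷ xs) = sumℤ (toList xs) ∷ suffixSums xs

maxℤ : List ℤ → ℤ
maxℤ = List.foldr _⊔ℤ_ (+ 0)

maxSuffix : ∀ {k} → Vec ℕ k → Vec ℕ k → ℤ
maxSuffix c d = maxℤ (toList (suffixSums (differences c d)))

-- m_i = M − S_i with S_i the suffix sums of c − d and M = max(0, S_1, …, S_{r−1}):
-- the numbers of parts N that turn a cylindric partition of profile d into one of profile c.
multiplicities : ∀ {k} → Vec ℕ k → Vec ℕ k → Vec ℕ k
multiplicities c d = Vec.map (λ s → ∣ maxSuffix c d -ℤ s ∣) (suffixSums (differences c d))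

maxℤ-suffixSums : ∀ {k} (xs : Vec ℤ k) →
  maxℤ (map (λ t → sumℤ (List.drop t (toList xs))) (map suc (upTo (k ∸ 1)))) ≡ maxℤ (toList (suffixSums xs))
maxℤ-suffixSums {k} xs = trans (cong maxℤ (sym (Listₚ.map-∘ (upTo (k ∸ 1))))) (go xs)
  where
  go : ∀ {k} (xs : Vec ℤ k) → maxℤ (map (λ t → sumℤ (List.drop (suc t) (toList xs))) (upTo (k ∸ 1))) ≡ maxℤ (toList (suffixSums xs))
  go [] = refl
  go (x ∷ []) = refl
  go {suc (suc k)} (x ∷ y ∷ ys) = trans (cong maxℤ (map-upTo-suc (λ t → sumℤ (List.drop (suc t) (toList (x ∷ y ∷ ys)))) k))
                                      (cong (sumℤ (toList (y ∷ ys)) ⊔ℤ_) (go (y ∷ ys)))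

weightedDifference : ∀ {k} → ℕ → Vec ℕ k → Vec ℕ k → ℤ
weightedDifference {k} j c d = sumUpTo k (λ i → + (j + i) *ℤ (+ nth0 (toList d) i -ℤ + nth0 (toList c) i))

abel-step : ∀ j x y w s t → (j *ℤ (y -ℤ x) +ℤ w) +ℤ (j *ℤ ((x -ℤ y) +ℤ s) +ℤ (s +ℤ t)) ≡ w +ℤ ((j +ℤ + 1) *ℤ s +ℤ t)
abel-step = solve-∀

-- Abel summation:  Σ_i i (d_i − c_i) = − Σ_i S_i(c − d).
abel-summation : ∀ {k} j (c d : Vec ℕ k) →
  weightedDifference j c d +ℤ ((+ j) *ℤ sumℤ (toList (differences c d)) +ℤ sumℤ (toList (suffixSums (differences c d)))) ≡ + 0
abel-summation j [] [] = trans (ℤₚ.+-identityˡ _) (trans (ℤₚ.+-identityʳ _) (ℤₚ.*-zeroʳ (+ j)))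
abel-summation {suc k} j (x ∷ c) (y ∷ d) = begin
  weightedDifference j (x ∷ c) (y ∷ d) +ℤ ((+ j) *ℤ ((+ x -ℤ + y) +ℤ S) +ℤ (S +ℤ U))
    ≡⟨ cong (_+ℤ ((+ j) *ℤ ((+ x -ℤ + y) +ℤ S) +ℤ (S +ℤ U))) first-term ⟩
  ((+ j) *ℤ (+ y -ℤ + x) +ℤ weightedDifference (suc j) c d) +ℤ ((+ j) *ℤ ((+ x -ℤ + y) +ℤ S) +ℤ (S +ℤ U))
    ≡⟨ abel-step (+ j) (+ x) (+ y) (weightedDifference (suc j) c d) S U ⟩
  weightedDifference (suc j) c d +ℤ (((+ j) +ℤ + 1) *ℤ S +ℤ U)
    ≡⟨ cong (λ z → weightedDifference (suc j) c d +ℤ (z *ℤ S +ℤ U)) (trans (sym (ℤₚ.pos-+ j 1)) (cong +_ (ℕₚ.+-comm j 1))) ⟩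
  weightedDifference (suc j) c d +ℤ ((+ suc j) *ℤ S +ℤ U)
    ≡⟨ abel-summation (suc j) c d ⟩
  + 0 ∎
  where
  open ≡-Reasoning
  S = sumℤ (toList (differences c d))
  U = sumℤ (toList (suffixSums (differences c d)))
  first-term : weightedDifference j (x ∷ c) (y ∷ d) ≡ (+ j) *ℤ (+ y -ℤ + x) +ℤ weightedDifference (suc j) c d
  first-term = trans (sumUpTo-suc k (λ i → + (j + i) *ℤ (+ nth0 (toList (y ∷ d)) i -ℤ + nth0 (toList (x ∷ c)) i)))
    (cong₂ _+ℤ_ (cong (λ z → + z *ℤ (+ y -ℤ + x)) (ℕₚ.+-identityʳ j))
                (sumUpTo-cong k (λ i _ → cong (λ z → + z *ℤ (+ nth0 (toList d) i -ℤ + nth0 (toList c) i)) (ℕₚ.+-suc j i))))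

≤maxℤ : ∀ {k} (v : Vec ℤ k) → All (_≤ℤ maxℤ (toList v)) v
≤maxℤ [] = []
≤maxℤ (x ∷ v) = ℤₚ.i≤i⊔j x (maxℤ (toList v)) ∷ All.map (λ s≤max → ℤₚ.≤-trans s≤max (ℤₚ.i≤j⊔i x _)) (≤maxℤ v)

0≤maxℤ : ∀ zs → + 0 ≤ℤ maxℤ zs
0≤maxℤ [] = ℤₚ.≤-refl
0≤maxℤ (z ∷ zs) = ℤₚ.≤-trans (0≤maxℤ zs) (ℤₚ.i≤j⊔i z (maxℤ zs))

maxℤ-≤ : ∀ {k} (v : Vec ℤ k) {B} → + 0 ≤ℤ B → All (_≤ℤ B) v → maxℤ (toList v) ≤ℤ B
maxℤ-≤ [] 0≤B _ = 0≤B
maxℤ-≤ (x ∷ v) 0≤B (x≤B ∷ v≤B) = ℤₚ.⊔-lub x≤B (maxℤ-≤ v 0≤B v≤B)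

maxℤ-attained : ∀ {k} (v : Vec ℤ k) → maxℤ (toList v) ≡ + 0 ⊎ Any (maxℤ (toList v) ≡_) v
maxℤ-attained [] = inj₁ refl
maxℤ-attained (x ∷ v) with ℤₚ.⊔-sel x (maxℤ (toList v))
... | inj₁ eq = inj₂ (here eq)
... | inj₂ eq with maxℤ-attained v
...   | inj₁ eq₀ = inj₁ (trans eq eq₀)
...   | inj₂ some = inj₂ (there (Any.map (trans eq) some))

sum-∣M-s∣ : ∀ {k} M (v : Vec ℤ k) → All (_≤ℤ M) v →
  + sum (toList (Vec.map (λ s → ∣ M -ℤ s ∣) v)) ≡ (+ k) *ℤ M -ℤ sumℤ (toList v)
sum-∣M-s∣ M [] _ = sym (cong (_-ℤ + 0) (ℤₚ.*-zeroˡ M))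
sum-∣M-s∣ {suc k} M (x ∷ v) (x≤M ∷ v≤M) = begin
  + (∣ M -ℤ x ∣ + sum (toList (Vec.map (λ s → ∣ M -ℤ s ∣) v)))
    ≡⟨ ℤₚ.pos-+ ∣ M -ℤ x ∣ _ ⟩
  + ∣ M -ℤ x ∣ +ℤ + sum (toList (Vec.map (λ s → ∣ M -ℤ s ∣) v))
    ≡⟨ cong₂ _+ℤ_ (ℤₚ.0≤i⇒+∣i∣≡i (ℤₚ.i≤j⇒0≤j-i x≤M)) (sum-∣M-s∣ M v v≤M) ⟩
  (M -ℤ x) +ℤ ((+ k) *ℤ M -ℤ sumℤ (toList v))
    ≡⟨ regroup M x (+ k) (sumℤ (toList v)) ⟩
  ((+ 1) +ℤ (+ k)) *ℤ M -ℤ (x +ℤ sumℤ (toList v))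
    ≡⟨ cong (λ z → z *ℤ M -ℤ (x +ℤ sumℤ (toList v))) (sym (ℤₚ.pos-+ 1 k)) ⟩
  (+ suc k) *ℤ M -ℤ (x +ℤ sumℤ (toList v)) ∎
  where
  open ≡-Reasoning
  regroup : ∀ M x K S → (M -ℤ x) +ℤ (K *ℤ M -ℤ S) ≡ ((+ 1) +ℤ K) *ℤ M -ℤ (x +ℤ S)
  regroup = solve-∀

Δ-regroup : ∀ W S U K → W +ℤ K ≡ (W +ℤ ((+ 0) *ℤ S +ℤ U)) +ℤ (K -ℤ U)
Δ-regroup = solve-∀

Δ≡sum-multiplicities : ∀ {k} (c d : Vec ℕ k) → Δ c d ≡ + vsum (multiplicities c d)
Δ≡sum-multiplicities {k} c d = begin
  Δ c d
    ≡⟨ cong (λ z → W +ℤ (+ k) *ℤ maxℤ (map (λ t → sumℤ (List.drop t z)) (map suc (upTo (k ∸ 1))))) (sym (toList-differences c d)) ⟩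
  W +ℤ (+ k) *ℤ maxℤ (map (λ t → sumℤ (List.drop t (toList (differences c d)))) (map suc (upTo (k ∸ 1))))
    ≡⟨ cong (λ z → W +ℤ (+ k) *ℤ z) (maxℤ-suffixSums (differences c d)) ⟩
  W +ℤ (+ k) *ℤ M
    ≡⟨ Δ-regroup W S U ((+ k) *ℤ M) ⟩
  (W +ℤ ((+ 0) *ℤ S +ℤ U)) +ℤ ((+ k) *ℤ M -ℤ U)
    ≡⟨ cong (_+ℤ ((+ k) *ℤ M -ℤ U)) (abel-summation 0 c d) ⟩
  + 0 +ℤ ((+ k) *ℤ M -ℤ U)
    ≡⟨ ℤₚ.+-identityˡ _ ⟩
  (+ k) *ℤ M -ℤ U
    ≡⟨ sum-∣M-s∣ M (suffixSums (differences c d)) (≤maxℤ (suffixSums (differences c d))) ⟨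
  + vsum (multiplicities c d) ∎
  where
  open ≡-Reasoning
  W = weightedDifference 0 c d
  M = maxSuffix c d
  S = sumℤ (toList (differences c d))
  U = sumℤ (toList (suffixSums (differences c d)))

-- Chain c d p ms: Shifted c_i m_{i−1} m_i d_i for every i, where m_{−1} = p.
Chain : ∀ {k} → Vec ℕ k → Vec ℕ k → ℕ → Vec ℕ k → Set
Chain [] [] p [] = ⊤
Chain (c ∷ cs) (d ∷ ds) p (m ∷ ms) = Shifted c p m d × Chain cs ds m ms

Chain⇒Pointwise₄ : ∀ {k} (c d ms : Vec ℕ (suc k)) p → Chain c d p ms → Pointwise₄ Shifted c (p ∷ Vec.init ms) ms d
Chain⇒Pointwise₄ (_ ∷ []) (_ ∷ []) (_ ∷ []) p (sh , _) = sh , tt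
Chain⇒Pointwise₄ (_ ∷ c ∷ cs) (_ ∷ d ∷ ds) (m ∷ m′ ∷ ms) p (sh , ch) = sh , Chain⇒Pointwise₄ (c ∷ cs) (d ∷ ds) (m′ ∷ ms) m ch

Pointwise₄⇒Chain : ∀ {k} (c d ms : Vec ℕ (suc k)) p → Pointwise₄ Shifted c (p ∷ Vec.init ms) ms d → Chain c d p ms
Pointwise₄⇒Chain (_ ∷ []) (_ ∷ []) (_ ∷ []) p (sh , _) = sh , tt
Pointwise₄⇒Chain (_ ∷ c ∷ cs) (_ ∷ d ∷ ds) (m ∷ m′ ∷ ms) p (sh , ch) = sh , Pointwise₄⇒Chain (c ∷ cs) (d ∷ ds) (m′ ∷ ms) m ch

Chain⇒cyclic : ∀ {k} (c d ms : Vec ℕ (suc k)) → Chain c d (Vec.last ms) ms → Pointwise₄ Shifted (rotV c) ms (rotV ms) (rotV d)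
Chain⇒cyclic c d ms ch = subst (λ v → Pointwise₄ Shifted (rotV c) v (rotV ms) (rotV d)) (rotV-unrotV ms)
  (Pointwise₄-rotV Shifted c (unrotV ms) ms d (Chain⇒Pointwise₄ c d ms (Vec.last ms) ch))

vsum-Chain : ∀ {k} (cs ds : Vec ℕ k) p ms → Chain cs ds p ms → vsum cs + p ≡ vsum ds + Vec.last (p ∷ ms)
vsum-Chain [] [] p [] _ = refl
vsum-Chain (c ∷ cs) (d ∷ ds) p (m ∷ ms) (sh , ch) = begin
  (c + vsum cs) + p                       ≡⟨ right-comm c (vsum cs) p ⟩
  (c + p) + vsum cs                       ≡⟨ cong (_+ vsum cs) sh ⟩
  (d + m) + vsum cs                       ≡⟨ trans (ℕₚ.+-assoc d m (vsum cs)) (cong (_+_ d) (ℕₚ.+-comm m (vsum cs))) ⟩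
  d + (vsum cs + m)                       ≡⟨ cong (_+_ d) (vsum-Chain cs ds m ms ch) ⟩
  d + (vsum ds + Vec.last (m ∷ ms))       ≡⟨ ℕₚ.+-assoc d _ _ ⟨
  (d + vsum ds) + Vec.last (m ∷ ms)       ∎
  where
  open ≡-Reasoning
  right-comm : ∀ a b c → a + b + c ≡ a + c + b
  right-comm = ℕ-solve-∀

Chain-self : ∀ {k} (c : Vec ℕ k) p ms → Chain c c p ms → ms ≡ Vec.replicate k p
Chain-self [] p [] _ = refl
Chain-self (c ∷ cs) p (m ∷ ms) (sh , ch) with ℕₚ.+-cancelˡ-≡ c p m sh
... | refl = cong (p ∷_) (Chain-self cs p ms ch)

Chain-zero : ∀ {k} (c d : Vec ℕ k) → Chain c d 0 (Vec.replicate k 0) → c ≡ d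
Chain-zero [] [] _ = refl
Chain-zero (c ∷ cs) (d ∷ ds) (sh , ch) =
  cong₂ _∷_ (trans (sym (ℕₚ.+-identityʳ c)) (trans sh (ℕₚ.+-identityʳ d))) (Chain-zero cs ds ch)

sum-differences-Chain : ∀ {k} (cs ds : Vec ℕ k) p ms → Chain cs ds p ms →
  sumℤ (toList (differences cs ds)) ≡ + Vec.last (p ∷ ms) -ℤ + p
sum-differences-Chain [] [] p [] _ = sym (ℤₚ.+-inverseʳ (+ p))
sum-differences-Chain (c ∷ cs) (d ∷ ds) p (m ∷ ms) (sh , ch) = begin
  (+ c -ℤ + d) +ℤ sumℤ (toList (differences cs ds))           ≡⟨ cong₂ (λ a b → (a -ℤ + d) +ℤ b) c≡ (sum-differences-Chain cs ds m ms ch) ⟩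
  (((+ d +ℤ + m) -ℤ + p) -ℤ + d) +ℤ (+ L -ℤ + m)              ≡⟨ telescope (+ d) (+ m) (+ p) (+ L) ⟩
  + L -ℤ + p                                                  ∎
  where
  open ≡-Reasoning
  L = Vec.last (m ∷ ms)
  telescope : ∀ d m p l → (((d +ℤ m) -ℤ p) -ℤ d) +ℤ (l -ℤ m) ≡ l -ℤ p
  telescope = solve-∀
  unshift : ∀ c p → c ≡ (c +ℤ p) -ℤ p
  unshift = solve-∀
  c≡ : + c ≡ (+ d +ℤ + m) -ℤ + p
  c≡ = trans (unshift (+ c) (+ p)) (cong (_-ℤ + p) (trans (sym (ℤₚ.pos-+ c p)) (trans (cong +_ sh) (ℤₚ.pos-+ d m))))

suffixSums-Chain : ∀ {k} (cs ds : Vec ℕ k) p ms → Chain cs ds p ms →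
  suffixSums (differences cs ds) ≡ Vec.map (λ x → + Vec.last (p ∷ ms) -ℤ + x) ms
suffixSums-Chain [] [] p [] _ = refl
suffixSums-Chain (c ∷ cs) (d ∷ ds) p (m ∷ ms) (_ , ch) =
  cong₂ _∷_ (sum-differences-Chain cs ds m ms ch) (suffixSums-Chain cs ds m ms ch)

maxℤ-L-minus : ∀ {k} (ms : Vec ℕ k) L → Any (_≡ 0) ms → maxℤ (toList (Vec.map (λ x → + L -ℤ + x) ms)) ≡ + L
maxℤ-L-minus ms L some = ℤₚ.≤-antisym (maxℤ-≤ _ (ℤ.+≤+ z≤n) (≤L ms)) (L≤ ms some)
  where
  ≤L : ∀ {k} (ms : Vec ℕ k) → All (_≤ℤ + L) (Vec.map (λ x → + L -ℤ + x) ms)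
  ≤L [] = []
  ≤L (x ∷ ms) = ℤₚ.i-j≤i (+ L) (+ x) ∷ ≤L ms
  L≤ : ∀ {k} (ms : Vec ℕ k) → Any (_≡ 0) ms → + L ≤ℤ maxℤ (toList (Vec.map (λ x → + L -ℤ + x) ms))
  L≤ (.0 ∷ ms) (here refl) = ℤₚ.≤-trans (ℤₚ.≤-reflexive (sym (ℤₚ.+-identityʳ (+ L)))) (ℤₚ.i≤i⊔j _ _)
  L≤ (x ∷ ms) (there some) = ℤₚ.≤-trans (L≤ ms some) (ℤₚ.i≤j⊔i _ _)

multiplicities-unique : ∀ {k} (c d ms : Vec ℕ (suc k)) → Chain c d (Vec.last ms) ms → Any (_≡ 0) ms →
  multiplicities c d ≡ ms
multiplicities-unique c d ms ch some
  rewrite suffixSums-Chain c d (Vec.last ms) ms ch | maxℤ-L-minus ms (Vec.last ms) some = back ms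
  where
  L-[L-x] : ∀ l x → l -ℤ (l -ℤ x) ≡ x
  L-[L-x] = solve-∀
  back : ∀ {k} (ms′ : Vec ℕ k) → Vec.map (λ s → ∣ + Vec.last ms -ℤ s ∣) (Vec.map (λ x → + Vec.last ms -ℤ + x) ms′) ≡ ms′
  back [] = refl
  back (x ∷ ms′) = cong₂ _∷_ (cong ∣_∣ (L-[L-x] (+ Vec.last ms) (+ x))) (back ms′)

sum-differences : ∀ {k} (c d : Vec ℕ k) → sumℤ (toList (differences c d)) ≡ + vsum c -ℤ + vsum d
sum-differences [] [] = refl
sum-differences (x ∷ c) (y ∷ d) = begin
  (+ x -ℤ + y) +ℤ sumℤ (toList (differences c d))   ≡⟨ cong (_+ℤ_ (+ x -ℤ + y)) (sum-differences c d) ⟩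
  (+ x -ℤ + y) +ℤ (+ vsum c -ℤ + vsum d)            ≡⟨ regroup (+ x) (+ y) (+ vsum c) (+ vsum d) ⟩
  (+ x +ℤ + vsum c) -ℤ (+ y +ℤ + vsum d)            ≡⟨ cong₂ _-ℤ_ (ℤₚ.pos-+ x (vsum c)) (ℤₚ.pos-+ y (vsum d)) ⟨
  + (x + vsum c) -ℤ + (y + vsum d)                  ∎
  where
  open ≡-Reasoning
  regroup : ∀ x y c d → (x -ℤ y) +ℤ (c -ℤ d) ≡ (x +ℤ c) -ℤ (y +ℤ d)
  regroup = solve-∀

Chain-∣M-S∣ : ∀ {k} (cs ds : Vec ℕ k) p M → + p ≡ M -ℤ sumℤ (toList (differences cs ds)) →
  All (_≤ℤ M) (suffixSums (differences cs ds)) → Chain cs ds p (Vec.map (λ s → ∣ M -ℤ s ∣) (suffixSums (differences cs ds)))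
Chain-∣M-S∣ [] [] p M _ _ = tt
Chain-∣M-S∣ (c ∷ cs) (d ∷ ds) p M p≡ (S≤M ∷ Ss≤M) = ℤₚ.+-injective c+p≡d+m , Chain-∣M-S∣ cs ds m M m≡ Ss≤M
  where
  S = sumℤ (toList (differences cs ds))
  m = ∣ M -ℤ S ∣
  m≡ : + m ≡ M -ℤ S
  m≡ = ℤₚ.0≤i⇒+∣i∣≡i (ℤₚ.i≤j⇒0≤j-i S≤M)
  regroup : ∀ c d M S → c +ℤ (M -ℤ ((c -ℤ d) +ℤ S)) ≡ d +ℤ (M -ℤ S)
  regroup = solve-∀
  c+p≡d+m : + (c + p) ≡ + (d + m)
  c+p≡d+m = begin
    + (c + p)                               ≡⟨ ℤₚ.pos-+ c p ⟩
    + c +ℤ + p                              ≡⟨ cong (_+ℤ_ (+ c)) p≡ ⟩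
    + c +ℤ (M -ℤ ((+ c -ℤ + d) +ℤ S))       ≡⟨ regroup (+ c) (+ d) M S ⟩
    + d +ℤ (M -ℤ S)                         ≡⟨ cong (_+ℤ_ (+ d)) m≡ ⟨
    + d +ℤ + m                              ≡⟨ ℤₚ.pos-+ d m ⟨
    + (d + m)                               ∎
    where open ≡-Reasoning

last-suffixSums : ∀ {k} (v : Vec ℤ (suc k)) → Vec.last (suffixSums v) ≡ + 0
last-suffixSums (x ∷ []) = refl
last-suffixSums (x ∷ y ∷ v) = last-suffixSums (y ∷ v)

last-map : ∀ {A B : Set} (f : A → B) {k} (v : Vec A (suc k)) → Vec.last (Vec.map f v) ≡ f (Vec.last v)
last-map f (x ∷ []) = refl
last-map f (x ∷ y ∷ v) = last-map f (y ∷ v)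

multiplicities-Chain : ∀ {k} (c d : Vec ℕ (suc k)) → vsum c ≡ vsum d →
  Chain c d (Vec.last (multiplicities c d)) (multiplicities c d)
multiplicities-Chain c d Σc≡Σd = Chain-∣M-S∣ c d _ M last≡ (≤maxℤ (suffixSums (differences c d)))
  where
  M = maxSuffix c d
  last≡ : + Vec.last (multiplicities c d) ≡ M -ℤ sumℤ (toList (differences c d))
  last≡ = begin
    + Vec.last (multiplicities c d)           ≡⟨ cong +_ (trans (last-map _ (suffixSums (differences c d)))
                                                                (cong (λ s → ∣ M -ℤ s ∣) (last-suffixSums (differences c d)))) ⟩
    + ∣ M -ℤ + 0 ∣                             ≡⟨ ℤₚ.0≤i⇒+∣i∣≡i (ℤₚ.i≤j⇒0≤j-i (0≤maxℤ (toList (suffixSums (differences c d))))) ⟩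
    M -ℤ + 0                                  ≡⟨ cong (M -ℤ_) (trans (cong (λ z → + z -ℤ + vsum d) Σc≡Σd) (ℤₚ.+-inverseʳ (+ vsum d))) ⟨
    M -ℤ (+ vsum c -ℤ + vsum d)               ≡⟨ cong (M -ℤ_) (sum-differences c d) ⟨
    M -ℤ sumℤ (toList (differences c d))      ∎
    where open ≡-Reasoning

-- The maximum M is attained either by some S_i or by 0 = S_{r}; either way some m_i vanishes.
multiplicities-has-zero : ∀ {k} (c d : Vec ℕ (suc k)) → Any (_≡ 0) (multiplicities c d)
multiplicities-has-zero c d with maxℤ-attained (suffixSums (differences c d))
... | inj₂ attained = Anyₚ.map⁺ (Any.map (λ {s} M≡s → cong ∣_∣ (trans (cong (_-ℤ s) M≡s) (ℤₚ.+-inverseʳ s))) attained)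
... | inj₁ M≡0 = Anyₚ.map⁺ (Any-last (suffixSums (differences c d))
                             (cong ∣_∣ (cong₂ _-ℤ_ M≡0 (last-suffixSums (differences c d)))))

isCylindric⁻ : ∀ {k} (d : Vec ℕ (suc k)) Λ → T (isCylindric d Λ) →
  T (List.all isPartition (toList Λ)) × T (pairsOK (toList Λ) (toList (rotV Λ)) (toList (rotV d)))
isCylindric⁻ d Λ t with ∧-split {List.all isPartition (toList Λ)} t
... | t₁ , t₂ = t₁ , subst₂ (λ a b → T (pairsOK (toList Λ) a b)) (sym (toList-rotV Λ)) (sym (toList-rotV d)) t₂

isCylindric⁺ : ∀ {k} (d : Vec ℕ (suc k)) Λ → T (List.all isPartition (toList Λ)) →
  T (pairsOK (toList Λ) (toList (rotV Λ)) (toList (rotV d))) → T (isCylindric d Λ)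
isCylindric⁺ d Λ t₁ t₂ = ∧-join t₁ (subst₂ (λ a b → T (pairsOK (toList Λ) a b)) (toList-rotV Λ) (toList-rotV d) t₂)

module _ (N : ℕ) {k : ℕ} (c ms : Vec ℕ (suc k)) (μ : Vec (List ℕ) (suc k)) where

  private
    rotV-padAll : rotV (padAll N ms μ) ≡ padAll N (rotV ms) (rotV μ)
    rotV-padAll = rotV-zipWith (pad N) ms μ

  isCylindric-unpad : ∀ d → Pointwise₄ Shifted (rotV c) ms (rotV ms) (rotV d) →
    T (isCylindric c (padAll N ms μ)) → T (isCylindric d μ)
  isCylindric-unpad d sh t with isCylindric⁻ c (padAll N ms μ) t
  ... | t₁ , t₂ = isCylindric⁺ d μ (allPartitions-unpad N ms μ t₁)
    (pairsOK-unpad N (rotV c) ms (rotV ms) (rotV d) μ (rotV μ) sh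
      (subst (λ z → T (pairsOK (toList (padAll N ms μ)) (toList z) (toList (rotV c)))) rotV-padAll t₂))

  isCylindric-pad : ∀ d → 1 ≤ N → Pointwise₄ Shifted (rotV c) ms (rotV ms) (rotV d) → All (AtMost N) μ →
    T (isCylindric d μ) → T (isCylindric c (padAll N ms μ))
  isCylindric-pad d 1≤N sh μ≤N t with isCylindric⁻ d μ t
  ... | t₁ , t₂ = isCylindric⁺ c (padAll N ms μ) (allPartitions-pad N ms μ 1≤N μ≤N t₁)
    (subst (λ z → T (pairsOK (toList (padAll N ms μ)) (toList z) (toList (rotV c)))) (sym rotV-padAll)
      (pairsOK-pad N (rotV c) ms (rotV ms) (rotV d) μ (rotV μ) sh (All-rotV μ≤N) t₂))

  isCylindric-pad⇒Fits : All (λ a → nth0 a 0 < N) μ → T (isCylindric c (padAll N ms μ)) →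
    Pointwise₄ Fits (rotV c) ms (rotV ms) (rotV c)
  isCylindric-pad⇒Fits μ₀<N t = pairsOK-pad⇒Fits N (rotV c) ms (rotV ms) μ (rotV μ) μ₀<N
    (subst (λ z → T (pairsOK (toList (padAll N ms μ)) (toList z) (toList (rotV c)))) rotV-padAll
      (proj₂ (isCylindric⁻ c (padAll N ms μ) t)))

padAll-leading : ∀ N {k} (Λ : Vec (List ℕ) k) → padAll N (Vec.map (leading N) Λ) (Vec.map (dropLeading N) Λ) ≡ Λ
padAll-leading N [] = refl
padAll-leading N (x ∷ Λ) = cong₂ _∷_ (pad-leading N x) (padAll-leading N Λ)

leading-padAll : ∀ n {k} (ms : Vec ℕ k) μ → All (AtMost n) μ → Vec.map (leading (suc n)) (padAll (suc n) ms μ) ≡ ms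
leading-padAll n [] [] _ = refl
leading-padAll n (m ∷ ms) (x ∷ μ) (x≤n ∷ μ≤n) = cong₂ _∷_ (leading-pad n m x x≤n) (leading-padAll n ms μ μ≤n)

dropLeading-padAll : ∀ n {k} (ms : Vec ℕ k) μ → All (AtMost n) μ → Vec.map (dropLeading (suc n)) (padAll (suc n) ms μ) ≡ μ
dropLeading-padAll n [] [] _ = refl
dropLeading-padAll n (m ∷ ms) (x ∷ μ) (x≤n ∷ μ≤n) = cong₂ _∷_ (dropLeading-pad n m x x≤n) (dropLeading-padAll n ms μ μ≤n)

AtMost-padAll : ∀ N {k} (ms : Vec ℕ k) μ → All (AtMost N) μ → All (AtMost N) (padAll N ms μ)
AtMost-padAll N [] [] _ = []
AtMost-padAll N (m ∷ ms) (x ∷ μ) (x≤N ∷ μ≤N) = AtMost-pad N m x x≤N ∷ AtMost-padAll N ms μ μ≤N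

AtMost-unpadAll : ∀ {K} N {k} (ms : Vec ℕ k) μ → All (AtMost K) (padAll N ms μ) → All (AtMost K) μ
AtMost-unpadAll N [] [] _ = []
AtMost-unpadAll N (m ∷ ms) (x ∷ μ) (≤K ∷ ≤Ks) = AtMost-unpad N m x ≤K ∷ AtMost-unpadAll N ms μ ≤Ks

AtMost-dropLeadingAll : ∀ n {k} (Λ : Vec (List ℕ) k) → All (T ∘ decreasing) Λ → All (AtMost (suc n)) Λ →
  All (AtMost n) (Vec.map (dropLeading (suc n)) Λ)
AtMost-dropLeadingAll n [] _ _ = []
AtMost-dropLeadingAll n (x ∷ Λ) (d ∷ ds) (x≤N ∷ Λ≤N) = AtMost-dropLeading n x d x≤N ∷ AtMost-dropLeadingAll n Λ ds Λ≤N

padAll-zeros : ∀ N {k} (μ : Vec (List ℕ) k) → padAll N (Vec.replicate k 0) μ ≡ μ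
padAll-zeros N [] = refl
padAll-zeros N (x ∷ μ) = cong (x ∷_) (padAll-zeros N μ)

-- Boolean, so that splitting by it is a split by a proof-irrelevant condition.
hasZero : ∀ {k} → Vec ℕ k → Bool
hasZero [] = false
hasZero (zero ∷ v) = true
hasZero (suc x ∷ v) = hasZero v

hasZero⇒Any : ∀ {k} (v : Vec ℕ k) → T (hasZero v) → Any (_≡ 0) v
hasZero⇒Any (zero ∷ v) t = here refl
hasZero⇒Any (suc x ∷ v) t = there (hasZero⇒Any v t)

Any⇒hasZero : ∀ {k} (v : Vec ℕ k) → Any (_≡ 0) v → T (hasZero v)
Any⇒hasZero (zero ∷ v) _ = tt
Any⇒hasZero (suc x ∷ v) (there some) = Any⇒hasZero v some

¬hasZero⇒All : ∀ {k} (v : Vec ℕ k) → T (not (hasZero v)) → All (1 ≤_) v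
¬hasZero⇒All [] t = []
¬hasZero⇒All (suc x ∷ v) t = s≤s z≤n ∷ ¬hasZero⇒All v t

All⇒¬hasZero : ∀ {k} (v : Vec ℕ k) → All (1 ≤_) v → T (not (hasZero v))
All⇒¬hasZero [] _ = tt
All⇒¬hasZero (suc x ∷ v) (_ ∷ all) = All⇒¬hasZero v all

×-irrelevant : ∀ {A B : Set} → Irrelevant A → Irrelevant B → Irrelevant (A × B)
×-irrelevant irrA irrB (a , b) (a′ , b′) = cong₂ _,_ (irrA a a′) (irrB b b′)

Σ-≡ : ∀ {A : Set} {P : A → Set} → (∀ a → Irrelevant (P a)) → ∀ {a a′} (p : P a) (p′ : P a′) → a ≡ a′ → (a , p) ≡ (a′ , p′)
Σ-≡ irr {a} p p′ refl = cong (a ,_) (irr a p p′)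

Σ-↔ : ∀ {A : Set} {P Q : A → Set} → (∀ a → Irrelevant (P a)) → (∀ a → Irrelevant (Q a)) →
  (∀ {a} → P a → Q a) → (∀ {a} → Q a → P a) → Σ A P ↔ Σ A Q
Σ-↔ irrP irrQ to from = mk↔ₛ′ (λ (a , p) → a , to p) (λ (a , q) → a , from q)
  (λ (a , q) → cong (a ,_) (irrQ a _ _)) (λ (a , p) → cong (a ,_) (irrP a _ _))

×-congʳ-under : ∀ {P A B : Set} → (P → A ↔ B) → (P × A) ↔ (P × B)
×-congʳ-under A↔B = mk↔ₛ′ (λ (p , a) → p , Inverse.to (A↔B p) a) (λ (p , b) → p , Inverse.from (A↔B p) b)
  (λ (p , b) → cong (p ,_) (Inverse.strictlyInverseˡ (A↔B p) b))
  (λ (p , a) → cong (p ,_) (Inverse.strictlyInverseʳ (A↔B p) a))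

split-by : ∀ {A : Set} (P : A → Set) (b : A → Bool) →
  Σ A P ↔ (Σ A (λ a → P a × T (not (b a))) ⊎ Σ A (λ a → P a × T (b a)))
split-by {A} P b = mk↔ₛ′ to from to∘from from∘to
  where
  Sides = Σ A (λ a → P a × T (not (b a))) ⊎ Σ A (λ a → P a × T (b a))
  side : (a : A) → P a → (w : Bool) → b a ≡ w → Sides
  side a p false eq = inj₁ (a , p , subst (T ∘ not) (sym eq) tt)
  side a p true eq = inj₂ (a , p , subst T (sym eq) tt)
  to : Σ A P → Sides
  to (a , p) = side a p (b a) refl
  from : Sides → Σ A P
  from (inj₁ (a , p , _)) = a , p
  from (inj₂ (a , p , _)) = a , p
  to∘from : ∀ y → to (from y) ≡ y
  to∘from (inj₁ (a , p , t)) = go (b a) refl t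
    where
    go : ∀ w (eq : b a ≡ w) (t : T (not (b a))) → side a p w eq ≡ inj₁ (a , p , t)
    go false eq t = cong (λ t → inj₁ (a , p , t)) (Boolₚ.T-irrelevant _ _)
    go true eq t = ⊥-elim (subst (T ∘ not) eq t)
  to∘from (inj₂ (a , p , t)) = go (b a) refl t
    where
    go : ∀ w (eq : b a ≡ w) (t : T (b a)) → side a p w eq ≡ inj₂ (a , p , t)
    go true eq t = cong (λ t → inj₂ (a , p , t)) (Boolₚ.T-irrelevant _ _)
    go false eq t = ⊥-elim (subst T eq t)
  from∘to : ∀ x → from (to x) ≡ x
  from∘to (a , p) = go (b a) refl
    where
    go : ∀ w (eq : b a ≡ w) → from (side a p w eq) ≡ (a , p)
    go false _ = refl
    go true _ = refl

Fin-shift : ∀ {A : Set} (Q : A → Set) (s : A → ℕ) (h : ℕ → ℕ) → (∀ a → Irrelevant (Q a)) →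
  (∀ m → Fin (h m) ↔ Σ A (λ a → Q a × s a ≡ m)) →
  ∀ k m → Fin (shift 0 k h m) ↔ Σ A (λ a → Q a × k + s a ≡ m)
Fin-shift Q s h irr h↔ zero m = h↔ m
Fin-shift Q s h irr h↔ (suc k) zero = mk↔ₛ′ (λ ()) (λ { (_ , _ , ()) }) (λ { (_ , _ , ()) }) (λ ())
Fin-shift Q s h irr h↔ (suc k) (suc m) = ↔-trans (Fin-shift Q s h irr h↔ k m)
  (Σ-↔ (λ a → ×-irrelevant (irr a) ℕₚ.≡-irrelevant) (λ a → ×-irrelevant (irr a) ℕₚ.≡-irrelevant)
       (λ (q , eq) → q , cong suc eq) (λ (q , eq) → q , ℕₚ.suc-injective eq))

Fin-sum : ∀ {A : Set} (g : A → ℕ) xs → Fin (sum (map g xs)) ↔ AnyL (Fin ∘ g) xs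
Fin-sum g [] = ↔-trans Finₚ.0↔⊥ AnyLₚ.⊥↔Any[]
Fin-sum g (x ∷ xs) = ↔-trans Finₚ.+↔⊎ (↔-trans (↔-refl ⊎-↔ Fin-sum g xs) (AnyLₚ.∷↔ (Fin ∘ g)))

Any-filter : ∀ {A : Set} {P : A → Set} (P? : ∀ x → Dec (P x)) xs (Q : A → Set) →
  AnyL Q (List.filter P? xs) ↔ AnyL (λ x → T (does (P? x)) × Q x) xs
Any-filter P? [] Q = mk↔ₛ′ (λ ()) (λ ()) (λ ()) (λ ())
Any-filter P? (x ∷ xs) Q with does (P? x) in eq
... | true = mk↔ₛ′ (λ { (here q) → here (subst T (sym eq) tt , q) ; (there a) → there (Inverse.to IH a) })
                   (λ { (here (_ , q)) → here q ; (there a) → there (Inverse.from IH a) })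
                   (λ { (here (t , q)) → cong (λ t → here (t , q)) (Boolₚ.T-irrelevant _ _)
                      ; (there a) → cong there (Inverse.strictlyInverseˡ IH a) })
                   (λ { (here q) → refl ; (there a) → cong there (Inverse.strictlyInverseʳ IH a) })
  where IH = Any-filter P? xs Q
... | false = mk↔ₛ′ (there ∘ Inverse.to IH)
                    (λ { (here (t , _)) → ⊥-elim (subst T eq t) ; (there a) → Inverse.from IH a })
                    (λ { (here (t , _)) → ⊥-elim (subst T eq t) ; (there a) → cong there (Inverse.strictlyInverseˡ IH a) })
                    (Inverse.strictlyInverseʳ IH)
  where IH = Any-filter P? xs Q

Any-applyUpTo : ∀ (f : ℕ → ℕ) k (Q : ℕ → Set) → AnyL Q (List.applyUpTo f k) ↔ Σ ℕ (λ x → x < k × Q (f x))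
Any-applyUpTo f zero Q = mk↔ₛ′ (λ ()) (λ { (_ , () , _) }) (λ { (_ , () , _) }) (λ ())
Any-applyUpTo f (suc k) Q =
  ↔-trans (↔-sym (AnyLₚ.∷↔ Q)) (↔-trans (↔-refl ⊎-↔ Any-applyUpTo (f ∘ suc) k Q) index-suc)
  where
  index-suc : (Q (f 0) ⊎ Σ ℕ (λ x → x < k × Q (f (suc x)))) ↔ Σ ℕ (λ x → x < suc k × Q (f x))
  index-suc = mk↔ₛ′ (λ { (inj₁ q) → 0 , s≤s z≤n , q ; (inj₂ (x , x<k , q)) → suc x , s≤s x<k , q })
                    (λ { (zero , _ , q) → inj₁ q ; (suc x , s≤s x<k , q) → inj₂ (x , x<k , q) })
                    (λ { (zero , s≤s z≤n , q) → refl ; (suc x , s≤s x<k , q) → refl })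
                    (λ { (inj₁ q) → refl ; (inj₂ (x , x<k , q)) → refl })

Any-boxVecs : ∀ r ℓ (Q : Vec ℕ r → Set) → AnyL Q (boxVecs r ℓ) ↔ Σ (Vec ℕ r) (λ v → All (_< suc ℓ) v × Q v)
Any-boxVecs zero ℓ Q = mk↔ₛ′ (λ { (here q) → [] , [] , q }) (λ { ([] , [] , q) → here q })
  (λ { ([] , [] , q) → refl }) (λ { (here q) → refl })
Any-boxVecs (suc r) ℓ Q =
  ↔-trans (↔-sym (AnyLₚ.concat↔ {xss = map (λ x → map (x ∷_) (boxVecs r ℓ)) (upTo (suc ℓ))}))
  (↔-trans (↔-sym AnyLₚ.map↔)
  (↔-trans (AnyLₚ.Any-cong (λ x → ↔-trans (↔-sym AnyLₚ.map↔) (Any-boxVecs r ℓ (Q ∘ (x ∷_)))) ↔-refl)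
  (↔-trans (Any-applyUpTo id (suc ℓ) _) cons)))
  where
  cons : Σ ℕ (λ x → x < suc ℓ × Σ (Vec ℕ r) (λ v → All (_< suc ℓ) v × Q (x ∷ v))) ↔
         Σ (Vec ℕ (suc r)) (λ v → All (_< suc ℓ) v × Q v)
  cons = mk↔ₛ′ (λ (x , x< , v , v< , q) → x ∷ v , x< ∷ v< , q) (λ { (x ∷ v , x< ∷ v< , q) → x , x< , v , v< , q })
               (λ { (x ∷ v , x< ∷ v< , q) → refl }) (λ { (x , x< , v , v< , q) → refl })

CylindricAtMost : ∀ {r} → Vec ℕ r → ℕ → Vec (List ℕ) r → Set
CylindricAtMost d K Λ = T (isCylindric d Λ) × maxPart Λ ≤ K

CylindricMax : ∀ {r} → Vec ℕ r → ℕ → Vec (List ℕ) r → Set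
CylindricMax d K Λ = T (isCylindric d Λ) × maxPart Λ ≡ K

OfSize : ∀ {r} → (Vec (List ℕ) r → Set) → ℕ → Set
OfSize {r} Q m = Σ (Vec (List ℕ) r) (λ Λ → Q Λ × size Λ ≡ m)

CylindricAtMost-irrelevant : ∀ {r} (d : Vec ℕ r) K Λ → Irrelevant (CylindricAtMost d K Λ)
CylindricAtMost-irrelevant d K Λ = ×-irrelevant Boolₚ.T-irrelevant ℕₚ.≤-irrelevant

CylindricMax-irrelevant : ∀ {r} (d : Vec ℕ r) K Λ → Irrelevant (CylindricMax d K Λ)
CylindricMax-irrelevant d K Λ = ×-irrelevant Boolₚ.T-irrelevant ℕₚ.≡-irrelevant

OfSize-irrelevant : ∀ {r} {Q : Vec (List ℕ) r → Set} m → (∀ Λ → Irrelevant (Q Λ)) → ∀ Λ → Irrelevant (Q Λ × size Λ ≡ m)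
OfSize-irrelevant m irr Λ = ×-irrelevant (irr Λ) ℕₚ.≡-irrelevant

CPbounded↔ : ∀ r d K m → CPbounded r d K m ↔ OfSize (CylindricAtMost d K) m
CPbounded↔ r d K m = Σ-↔ (λ Λ → Boolₚ.T-irrelevant) (OfSize-irrelevant m (CylindricAtMost-irrelevant d K)) (λ {Λ} → to {Λ}) (λ {Λ} → from {Λ})
  where
  to : ∀ {Λ} → T (isCylindric d Λ ∧ (maxPart Λ ≤ᵇ K) ∧ (size Λ ≡ᵇ m)) → CylindricAtMost d K Λ × size Λ ≡ m
  to {Λ} t with ∧-split {isCylindric d Λ} t
  ... | t₁ , t₂₃ with ∧-split {maxPart Λ ≤ᵇ K} t₂₃
  ... | t₂ , t₃ = (t₁ , ℕₚ.≤ᵇ⇒≤ (maxPart Λ) K t₂) , ℕₚ.≡ᵇ⇒≡ (size Λ) m t₃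
  from : ∀ {Λ} → CylindricAtMost d K Λ × size Λ ≡ m → T (isCylindric d Λ ∧ (maxPart Λ ≤ᵇ K) ∧ (size Λ ≡ᵇ m))
  from {Λ} ((t , max≤K) , size≡m) = ∧-join t (∧-join (ℕₚ.≤⇒≤ᵇ max≤K) (ℕₚ.≡⇒≡ᵇ (size Λ) m size≡m))

CPexact↔ : ∀ r d K m → CPexact r d K m ↔ OfSize (CylindricMax d K) m
CPexact↔ r d K m = Σ-↔ (λ Λ → Boolₚ.T-irrelevant) (OfSize-irrelevant m (CylindricMax-irrelevant d K)) (λ {Λ} → to {Λ}) (λ {Λ} → from {Λ})
  where
  to : ∀ {Λ} → T (isCylindric d Λ ∧ (maxPart Λ ≡ᵇ K) ∧ (size Λ ≡ᵇ m)) → CylindricMax d K Λ × size Λ ≡ m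
  to {Λ} t with ∧-split {isCylindric d Λ} t
  ... | t₁ , t₂₃ with ∧-split {maxPart Λ ≡ᵇ K} t₂₃
  ... | t₂ , t₃ = (t₁ , ℕₚ.≡ᵇ⇒≡ (maxPart Λ) K t₂) , ℕₚ.≡ᵇ⇒≡ (size Λ) m t₃
  from : ∀ {Λ} → CylindricMax d K Λ × size Λ ≡ m → T (isCylindric d Λ ∧ (maxPart Λ ≡ᵇ K) ∧ (size Λ ≡ᵇ m))
  from {Λ} ((t , max≡K) , size≡m) = ∧-join t (∧-join (ℕₚ.≡⇒≡ᵇ (maxPart Λ) K max≡K) (ℕₚ.≡⇒≡ᵇ (size Λ) m size≡m))

AtMost-suc↔ : ∀ {r} (d : Vec ℕ r) n m →
  OfSize (CylindricAtMost d (suc n)) m ↔ (OfSize (CylindricAtMost d n) m ⊎ OfSize (CylindricMax d (suc n)) m)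
AtMost-suc↔ d n m = ↔-trans (split-by (λ Λ → CylindricAtMost d (suc n) Λ × size Λ ≡ m) (λ Λ → maxPart Λ ≡ᵇ suc n))
  (Σ-↔ (λ Λ → ×-irrelevant (OfSize-irrelevant m (CylindricAtMost-irrelevant d (suc n)) Λ) Boolₚ.T-irrelevant)
       (OfSize-irrelevant m (CylindricAtMost-irrelevant d n))
       (λ { (((t , max≤N) , size≡m) , max≢N) → (t , below max≤N max≢N) , size≡m })
       (λ { {Λ} ((t , max≤n) , size≡m) → ((t , ℕₚ.m≤n⇒m≤1+n max≤n) , size≡m) , subst (T ∘ not) (sym (≡ᵇ-suc-> max≤n)) tt })
   ⊎-↔
   Σ-↔ (λ Λ → ×-irrelevant (OfSize-irrelevant m (CylindricAtMost-irrelevant d (suc n)) Λ) Boolₚ.T-irrelevant)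
       (OfSize-irrelevant m (CylindricMax-irrelevant d (suc n)))
       (λ { {Λ} (((t , _) , size≡m) , max≡N) → (t , ℕₚ.≡ᵇ⇒≡ (maxPart Λ) (suc n) max≡N) , size≡m })
       (λ { {Λ} ((t , max≡N) , size≡m) → ((t , ℕₚ.≤-reflexive max≡N) , size≡m) , ℕₚ.≡⇒≡ᵇ (maxPart Λ) (suc n) max≡N }))
  where
  below : ∀ {x} → x ≤ suc n → T (not (x ≡ᵇ suc n)) → x ≤ n
  below {x} x≤N x≢N with ℕₚ.m≤n⇒m<n∨m≡n x≤N
  ... | inj₁ (s≤s x≤n) = x≤n
  ... | inj₂ refl = ⊥-elim (subst (T ∘ not) (≡ᵇ-refl (suc n)) x≢N)

module _ {k : ℕ} (c : Vec ℕ (suc k)) where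

  private
    r = suc k
    empty : Vec (List ℕ) r
    empty = Vec.replicate r []

  isCylindric-empty : T (isCylindric c empty)
  isCylindric-empty = isCylindric⁺ c empty (allPartitions r)
    (subst (λ Λ → T (pairsOK (toList empty) (toList Λ) (toList (rotV c)))) (sym (rotV-replicate k [])) (pairs (rotV c)))
    where
    allPartitions : ∀ r → T (List.all isPartition (toList (Vec.replicate r [])))
    allPartitions zero = tt
    allPartitions (suc r) = allPartitions r
    pairs : ∀ {r} (ds : Vec ℕ r) → T (pairsOK (toList (Vec.replicate r [])) (toList (Vec.replicate r [])) (toList ds))
    pairs [] = tt
    pairs (_ ∷ ds) = pairs ds

  maxPart-empty : ∀ r → maxPart (Vec.replicate r []) ≡ 0
  maxPart-empty zero = refl
  maxPart-empty (suc r) = maxPart-empty r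

  size-empty : ∀ r → size (Vec.replicate r []) ≡ 0
  size-empty zero = refl
  size-empty (suc r) = size-empty r

  -- Partitions have positive parts, so all parts at most 0 means no parts at all.
  AtMost-0⇒empty : ∀ {r} (Λ : Vec (List ℕ) r) → T (List.all isPartition (toList Λ)) → All (AtMost 0) Λ → Λ ≡ Vec.replicate r []
  AtMost-0⇒empty [] _ _ = refl
  AtMost-0⇒empty ([] ∷ Λ) t (_ ∷ ≤0) = cong ([] ∷_) (AtMost-0⇒empty Λ (proj₂ (∧-split {isPartition []} t)) ≤0)
  AtMost-0⇒empty ((y ∷ ys) ∷ Λ) t (y≤0 ∷ _) with ∧-split {isPartition (y ∷ ys)} t
  ... | part , _ = ⊥-elim (ℕₚ.<-irrefl refl (ℕₚ.≤-trans 1≤y (y≤0 0)))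
    where
    1≤y : 1 ≤ y
    1≤y = ℕₚ.≤ᵇ⇒≤ 1 y (proj₁ (∧-split {1 ≤ᵇ y} (proj₁ (∧-split {positive (y ∷ ys)} part))))

  Max-zero↔ : ∀ m → OfSize (CylindricMax c 0) m ↔ (m ≡ 0)
  Max-zero↔ m = mk↔ₛ′ (λ (Λ , (t , max≡0) , size≡m) → trans (sym size≡m) (subst (λ Λ → size Λ ≡ 0) (sym (is-empty Λ t max≡0)) (size-empty r)))
    (λ m≡0 → empty , (isCylindric-empty , maxPart-empty r) , trans (size-empty r) (sym m≡0))
    (λ _ → ℕₚ.≡-irrelevant _ _)
    (λ (Λ , p@((t , max≡0) , _)) → Σ-≡ (OfSize-irrelevant m (CylindricMax-irrelevant c 0)) _ p (sym (is-empty Λ t max≡0)))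
    where
    is-empty : ∀ Λ → T (isCylindric c Λ) → maxPart Λ ≡ 0 → Λ ≡ empty
    is-empty Λ t max≡0 = AtMost-0⇒empty Λ (proj₁ (isCylindric⁻ c Λ t)) (≤-maxPart 0 Λ (ℕₚ.≤-reflexive max≡0))

module _ (n : ℕ) {k : ℕ} (c : Vec ℕ (suc k)) where

  private
    N = suc n
    r = suc k
    ones = Vec.replicate r 1

    Shifted-ones : Pointwise₄ Shifted (rotV c) ones (rotV ones) (rotV c)
    Shifted-ones = subst (λ v → Pointwise₄ Shifted (rotV c) ones v (rotV c)) (sym (rotV-replicate k 1)) (refl-on (rotV c) ones)
      where
      refl-on : ∀ {k} (cs ms : Vec ℕ k) → Pointwise₄ Shifted cs ms ms cs
      refl-on [] [] = tt
      refl-on (_ ∷ cs) (_ ∷ ms) = refl , refl-on cs ms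

    size-ones : ∀ μ → size (padAll N ones μ) ≡ N * r + size μ
    size-ones μ = trans (size-padAll N ones μ) (cong (_+ size μ) (trans (cong (_* N) (vsum-ones r)) (ℕₚ.*-comm r N)))
      where
      vsum-ones : ∀ k → vsum (Vec.replicate k 1) ≡ k
      vsum-ones zero = refl
      vsum-ones (suc k) = cong suc (vsum-ones k)

    pad-drop : ∀ x → 1 ≤ leading N x → pad N 1 (List.drop 1 x) ≡ x
    pad-drop (y ∷ ys) 1≤ with y ≡ᵇ N in eq
    ... | true = cong (_∷ ys) (sym (ℕₚ.≡ᵇ⇒≡ y N (subst T (sym eq) tt)))

    padAll-drop : ∀ {k} (Λ : Vec (List ℕ) k) → All (λ x → 1 ≤ leading N x) Λ → padAll N (Vec.replicate k 1) (Vec.map (List.drop 1) Λ) ≡ Λ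
    padAll-drop [] _ = refl
    padAll-drop (x ∷ Λ) (1≤ ∷ 1≤s) = cong₂ _∷_ (pad-drop x 1≤) (padAll-drop Λ 1≤s)

    drop-padAll : ∀ {k} (μ : Vec (List ℕ) k) → Vec.map (List.drop 1) (padAll N (Vec.replicate k 1) μ) ≡ μ
    drop-padAll [] = refl
    drop-padAll (x ∷ μ) = cong (x ∷_) (drop-padAll μ)

    leading-padAll-ones : ∀ {k} (μ : Vec (List ℕ) k) → All (1 ≤_) (Vec.map (leading N) (padAll N (Vec.replicate k 1) μ))
    leading-padAll-ones [] = []
    leading-padAll-ones (x ∷ μ) rewrite ≡ᵇ-refl n = s≤s z≤n ∷ leading-padAll-ones μ

  AllContainN : ℕ → Set
  AllContainN m = Σ (Vec (List ℕ) r) (λ Λ → (CylindricMax c N Λ × size Λ ≡ m) × T (not (hasZero (Vec.map (leading N) Λ))))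

  remove-one-N↔ : ∀ m → AllContainN m ↔ Σ (Vec (List ℕ) r) (λ μ → CylindricAtMost c N μ × N * r + size μ ≡ m)
  remove-one-N↔ m = mk↔ₛ′ to from
    (λ (μ , p) → Σ-≡ (λ μ → ×-irrelevant (CylindricAtMost-irrelevant c N μ) ℕₚ.≡-irrelevant) _ p (drop-padAll μ))
    (λ (Λ , p@(_ , no0)) → Σ-≡ (λ Λ → ×-irrelevant (OfSize-irrelevant m (CylindricMax-irrelevant c N) Λ) Boolₚ.T-irrelevant) _ p
                                (padAll-drop Λ (Allₚ.map⁻ (¬hasZero⇒All _ no0))))
    where
    to : AllContainN m → Σ (Vec (List ℕ) r) (λ μ → CylindricAtMost c N μ × N * r + size μ ≡ m)
    to (Λ , ((t , max≡N) , size≡m) , no0) =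
      μ , (isCylindric-unpad N c ones μ c Shifted-ones t′ , maxPart-≤ N μ μ≤N) , trans (sym (size-ones μ)) (trans (cong size Λ≡) size≡m)
      where
      μ = Vec.map (List.drop 1) Λ
      Λ≡ : padAll N ones μ ≡ Λ
      Λ≡ = padAll-drop Λ (Allₚ.map⁻ (¬hasZero⇒All _ no0))
      t′ = subst (T ∘ isCylindric c) (sym Λ≡) t
      μ≤N : All (AtMost N) μ
      μ≤N = AtMost-unpadAll N ones μ (subst (All (AtMost N)) (sym Λ≡) (≤-maxPart N Λ (ℕₚ.≤-reflexive max≡N)))
    from : Σ (Vec (List ℕ) r) (λ μ → CylindricAtMost c N μ × N * r + size μ ≡ m) → AllContainN m
    from (μ , (t , max≤N) , size≡m) =
      padAll N ones μ , ((isCylindric-pad N c ones μ c (s≤s z≤n) Shifted-ones μ≤N t ,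
                          ℕₚ.≤-antisym (maxPart-≤ N (padAll N ones μ) (AtMost-padAll N ones μ μ≤N))
                                       (N≤maxPart-padAll N ones μ (here (s≤s z≤n)))) ,
                         trans (size-ones μ) size≡m) ,
      All⇒¬hasZero _ (leading-padAll-ones μ)
      where
      μ≤N = ≤-maxPart N μ max≤N

-- The profile left after removing m_i parts N from component i, where p_i = m_{i−1}.
reducedProfile : ∀ {k} → Vec ℕ k → Vec ℕ k → Vec ℕ k → Vec ℕ k
reducedProfile c ps ms = Vec.zipWith _∸_ (Vec.zipWith _+_ c ps) ms

Fits⇒Shifted : ∀ {k} (c ps ms : Vec ℕ k) → Pointwise₄ Fits c ps ms c → Pointwise₄ Shifted c ps ms (reducedProfile c ps ms)
Fits⇒Shifted [] [] [] _ = tt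
Fits⇒Shifted (c ∷ cs) (p ∷ ps) (m ∷ ms) (m≤c+p , fits) = sym (ℕₚ.m∸n+n≡m m≤c+p) , Fits⇒Shifted cs ps ms fits

Shifted⇒reducedProfile : ∀ {k} (c ps ms d : Vec ℕ k) → Pointwise₄ Shifted c ps ms d → reducedProfile c ps ms ≡ d
Shifted⇒reducedProfile [] [] [] [] _ = refl
Shifted⇒reducedProfile (c ∷ cs) (p ∷ ps) (m ∷ ms) (d ∷ ds) (sh , shs) =
  cong₂ _∷_ (trans (cong (_∸ m) sh) (ℕₚ.m+n∸n≡m d m)) (Shifted⇒reducedProfile cs ps ms ds shs)

module Decomposition (n : ℕ) {k : ℕ} (c : Vec ℕ (suc k)) (Λ : Vec (List ℕ) (suc k))
                     (cylindric : T (isCylindric c Λ)) (max≡N : maxPart Λ ≡ suc n) where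

  private
    N = suc n

  leadings : Vec ℕ (suc k)
  leadings = Vec.map (leading N) Λ

  remainders : Vec (List ℕ) (suc k)
  remainders = Vec.map (dropLeading N) Λ

  remainderProfile : Vec ℕ (suc k)
  remainderProfile = reducedProfile c (unrotV leadings) leadings

  padAll-remainders : padAll N leadings remainders ≡ Λ
  padAll-remainders = padAll-leading N Λ

  remainders≤n : All (AtMost n) remainders
  remainders≤n = AtMost-dropLeadingAll n Λ (allPartitions⇒decreasing Λ (proj₁ (isCylindric⁻ c Λ cylindric)))
                                         (≤-maxPart N Λ (ℕₚ.≤-reflexive max≡N))

  private
    cylindric′ : T (isCylindric c (padAll N leadings remainders))
    cylindric′ = subst (T ∘ isCylindric c) (sym padAll-remainders) cylindric

    shifted : Pointwise₄ Shifted c (unrotV leadings) leadings remainderProfile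
    shifted = Fits⇒Shifted c (unrotV leadings) leadings
      (subst₂ (λ a b → Pointwise₄ Fits a (unrotV leadings) b a) (unrotV-rotV c) (unrotV-rotV leadings)
        (Pointwise₄-unrotV Fits (rotV c) leadings (rotV leadings) (rotV c)
          (isCylindric-pad⇒Fits N c leadings remainders (All.map (λ ≤n → s≤s (≤n 0)) remainders≤n) cylindric′)))

  remainders-Chain : Chain c remainderProfile (Vec.last leadings) leadings
  remainders-Chain = Pointwise₄⇒Chain c remainderProfile leadings (Vec.last leadings) shifted

  remainders-cylindric : T (isCylindric remainderProfile remainders)
  remainders-cylindric = isCylindric-unpad N c leadings remainders remainderProfile
    (Chain⇒cyclic c remainderProfile leadings remainders-Chain) cylindric′

  vsum-remainderProfile : vsum remainderProfile ≡ vsum c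
  vsum-remainderProfile = sym (ℕₚ.+-cancelʳ-≡ _ (vsum c) (vsum remainderProfile)
    (vsum-Chain c remainderProfile (Vec.last leadings) leadings remainders-Chain))

  -- If the profile did not change, then by the chain all multiplicities are equal, hence all 0,
  -- contradicting maxPart Λ ≡ N.
  remainderProfile≢ : Any (_≡ 0) leadings → remainderProfile ≢ c
  remainderProfile≢ some d≡c = ℕₚ.<-irrefl refl (ℕₚ.≤-trans (ℕₚ.≤-reflexive (sym max≡N)) Λ≤n)
    where
    constant : leadings ≡ Vec.replicate (suc k) (Vec.last leadings)
    constant = Chain-self c _ leadings (subst (λ d → Chain c d (Vec.last leadings) leadings) d≡c remainders-Chain)
    zeros : leadings ≡ Vec.replicate (suc k) 0
    zeros = trans constant (cong (Vec.replicate (suc k)) (replicate-zero (suc k) (subst (Any (_≡ 0)) constant some)))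
      where
      replicate-zero : ∀ k {p} → Any (_≡ 0) (Vec.replicate k p) → p ≡ 0
      replicate-zero (suc k) (here p≡0) = p≡0
      replicate-zero (suc k) (there some) = replicate-zero k some
    Λ≤n : maxPart Λ ≤ n
    Λ≤n = subst (λ Λ → maxPart Λ ≤ n) padAll-remainders
            (subst (λ v → maxPart (padAll N v remainders) ≤ n) (sym zeros)
              (subst (λ Λ → maxPart Λ ≤ n) (sym (padAll-zeros N remainders)) (maxPart-≤ n remainders remainders≤n)))

isOther? : ∀ {r} (ℓ : ℕ) (c d : Vec ℕ r) → Dec (vsum d ≡ ℓ × d ≢ c)
isOther? ℓ c d = (vsum d ℕ.≟ ℓ) ×-dec ¬? (Vecₚ.≡-dec ℕ._≟_ d c)

does⁻ : ∀ {A : Set} (a? : Dec A) → T (does a?) → A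
does⁻ (yes a) _ = a

does⁺ : ∀ {A : Set} (a? : Dec A) → A → T (does a?)
does⁺ (yes _) _ = tt
does⁺ (no ¬a) a = ¬a a

weight : ∀ {r} → ℕ → Vec ℕ r → Vec ℕ r → ℕ
weight n c d = ∣ + suc n *ℤ Δ c d ∣

weight≡ : ∀ {r} n (c d : Vec ℕ r) → weight n c d ≡ suc n * vsum (multiplicities c d)
weight≡ n c d = trans (cong (λ z → ∣ + suc n *ℤ z ∣) (Δ≡sum-multiplicities c d)) (ℤₚ.abs-* (+ suc n) (+ vsum (multiplicities c d)))

module _ (n : ℕ) {k : ℕ} (ℓ : ℕ) (c : Vec ℕ (suc k)) where

  private
    N = suc n
    r = suc k

  SomeLacksN : ℕ → Set
  SomeLacksN m = Σ (Vec (List ℕ) r) (λ Λ → (CylindricMax c N Λ × size Λ ≡ m) × T (hasZero (Vec.map (leading N) Λ)))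

  Remainder : ℕ → Vec ℕ r → Set
  Remainder m d = Σ (Vec (List ℕ) r) (λ μ → CylindricAtMost d n μ × weight n c d + size μ ≡ m)

  OtherProfile : ℕ → Set
  OtherProfile m = Σ (Vec ℕ r) (λ d → T (does (isOther? ℓ c d)) × Remainder m d)

  private
    to : vsum c ≡ ℓ → ∀ m → SomeLacksN m → OtherProfile m
    to vsum-c m (Λ , ((t , max≡N) , size≡m) , some0) =
      d , does⁺ (isOther? ℓ c d) (trans vsum-remainderProfile vsum-c , remainderProfile≢ zero∈) ,
      μ , (remainders-cylindric , maxPart-≤ n μ remainders≤n) , size≡
      where
      open Decomposition n c Λ t max≡N
      ms = leadings
      μ = remainders
      d = remainderProfile
      zero∈ = hasZero⇒Any ms some0
      size≡ : weight n c d + size μ ≡ m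
      size≡ = begin
        weight n c d + size μ                           ≡⟨ cong (_+ size μ) (weight≡ n c d) ⟩
        N * vsum (multiplicities c d) + size μ          ≡⟨ cong (λ v → N * vsum v + size μ) (multiplicities-unique c d ms remainders-Chain zero∈) ⟩
        N * vsum ms + size μ                            ≡⟨ cong (_+ size μ) (ℕₚ.*-comm N (vsum ms)) ⟩
        vsum ms * N + size μ                            ≡⟨ size-padAll N ms μ ⟨
        size (padAll N ms μ)                            ≡⟨ cong size padAll-remainders ⟩
        size Λ                                          ≡⟨ size≡m ⟩
        m                                               ∎
        where open ≡-Reasoning

    module Rebuild (vsum-c : vsum c ≡ ℓ) (d : Vec ℕ r) (other : T (does (isOther? ℓ c d))) (μ : Vec (List ℕ) r) (μ≤n : maxPart μ ≤ n) where
      ms = multiplicities c d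
      chain : Chain c d (Vec.last ms) ms
      chain = multiplicities-Chain c d (trans vsum-c (sym (proj₁ (does⁻ (isOther? ℓ c d) other))))
      μ≤n′ : All (AtMost n) μ
      μ≤n′ = ≤-maxPart n μ μ≤n
      μ≤N : All (AtMost N) μ
      μ≤N = All.map (λ ≤n j → ℕₚ.m≤n⇒m≤1+n (≤n j)) μ≤n′
      -- All multiplicities 0 would force d ≡ c.
      some-positive : Any (1 ≤_) ms
      some-positive with Any.any? (λ m → 1 ℕ.≤? m) ms
      ... | yes some = some
      ... | no none = ⊥-elim (proj₂ (does⁻ (isOther? ℓ c d) other) (sym (Chain-zero c d
                (subst (λ p → Chain c d p zeros) (last-replicate k 0)
                  (subst (λ v → Chain c d (Vec.last v) v) (all-zero ms none) chain)))))
        where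
        zeros = Vec.replicate r 0
        last-replicate : ∀ k x → Vec.last (Vec.replicate (suc k) x) ≡ x
        last-replicate zero x = refl
        last-replicate (suc k) x = last-replicate k x
        all-zero : ∀ {k} (v : Vec ℕ k) → ¬ Any (1 ≤_) v → v ≡ Vec.replicate k 0
        all-zero [] _ = refl
        all-zero (zero ∷ v) none = cong (0 ∷_) (all-zero v (none ∘ there))
        all-zero (suc x ∷ v) none = ⊥-elim (none (here (s≤s z≤n)))
      Λ = padAll N ms μ

    from : vsum c ≡ ℓ → ∀ m → OtherProfile m → SomeLacksN m
    from vsum-c m (d , other , μ , (t , μ≤n) , size≡m) =
      Λ , ((isCylindric-pad N c ms μ d (s≤s z≤n) (Chain⇒cyclic c d ms chain) μ≤N t ,
            ℕₚ.≤-antisym (maxPart-≤ N Λ (AtMost-padAll N ms μ μ≤N)) (N≤maxPart-padAll N ms μ some-positive)) ,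
           size≡) ,
      subst (T ∘ hasZero) (sym (leading-padAll n ms μ μ≤n′)) (Any⇒hasZero ms (multiplicities-has-zero c d))
      where
      open Rebuild vsum-c d other μ μ≤n
      size≡ : size Λ ≡ m
      size≡ = trans (size-padAll N ms μ) (trans (cong (_+ size μ) (trans (ℕₚ.*-comm (vsum ms) N) (sym (weight≡ n c d)))) size≡m)

    OtherProfile-≡ : ∀ {m d d′ μ μ′} → d ≡ d′ → μ ≡ μ′ → ∀ o o′ q q′ →
      _≡_ {A = OtherProfile m} (d , o , μ , q) (d′ , o′ , μ′ , q′)
    OtherProfile-≡ {d = d} {μ = μ} refl refl o o′ q q′ =
      cong₂ (λ o q → d , o , μ , q) (Boolₚ.T-irrelevant o o′) (×-irrelevant (CylindricAtMost-irrelevant d n μ) ℕₚ.≡-irrelevant q q′)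

  -- Delete all parts N: the profile changes to d, and the deleted parts weigh N Δ(c, d).
  remove-all-N↔ : vsum c ≡ ℓ → ∀ m → SomeLacksN m ↔ OtherProfile m
  remove-all-N↔ vsum-c m = mk↔ₛ′ (to vsum-c m) (from vsum-c m) to∘from from∘to
    where
    to∘from : ∀ y → to vsum-c m (from vsum-c m y) ≡ y
    to∘from (d , other , μ , p@((_ , μ≤n) , _)) = OtherProfile-≡ d≡ (dropLeading-padAll n ms μ μ≤n′) _ other _ p
      where
      open Rebuild vsum-c d other μ μ≤n
      d≡ : reducedProfile c (unrotV (Vec.map (leading N) Λ)) (Vec.map (leading N) Λ) ≡ d
      d≡ = trans (cong (λ v → reducedProfile c (unrotV v) v) (leading-padAll n ms μ μ≤n′))
                 (Shifted⇒reducedProfile c _ ms d (Chain⇒Pointwise₄ c d ms _ chain))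
    from∘to : ∀ x → from vsum-c m (to vsum-c m x) ≡ x
    from∘to (Λ , p@(((t , max≡N) , _) , some0)) =
      Σ-≡ (λ Λ → ×-irrelevant (OfSize-irrelevant m (CylindricMax-irrelevant c N) Λ) Boolₚ.T-irrelevant) _ p
        (trans (cong (λ v → padAll N v remainders) (multiplicities-unique c _ _ remainders-Chain (hasZero⇒Any _ some0)))
               padAll-remainders)
      where open Decomposition n c Λ t max≡N

module Coefficients {k : ℕ} (ℓ : ℕ) (c : Vec ℕ (suc k)) (vsum-c : vsum c ≡ ℓ)
         (f : ℕ → Vec ℕ (suc k) → ℕ → ℕ) (f↔ : ∀ n d m → vsum d ≡ ℓ → Fin (f n d m) ↔ CPbounded (suc k) d n m)
         (fe : ℕ → ℕ → ℕ) (fe↔ : ∀ n m → Fin (fe n m) ↔ CPexact (suc k) c n m) where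

  private
    r = suc k
    open Related.EquationalReasoning {k = Related.bijection}

  f↔′ : ∀ n d m → vsum d ≡ ℓ → Fin (f n d m) ↔ OfSize (CylindricAtMost d n) m
  f↔′ n d m vsum-d = ↔-trans (f↔ n d m vsum-d) (CPbounded↔ r d n m)

  fe↔′ : ∀ n m → Fin (fe n m) ↔ OfSize (CylindricMax c n) m
  fe↔′ n m = ↔-trans (fe↔ n m) (CPexact↔ r c n m)

  bounded-suc : ∀ n m → f (suc n) c m ≡ f n c m + fe (suc n) m
  bounded-suc n m = ↔⇒≡ (begin
    Fin (f (suc n) c m)                                                    ↔⟨ f↔′ (suc n) c m vsum-c ⟩
    OfSize (CylindricAtMost c (suc n)) m                                   ↔⟨ AtMost-suc↔ c n m ⟩
    (OfSize (CylindricAtMost c n) m ⊎ OfSize (CylindricMax c (suc n)) m)  ↔⟨ f↔′ n c m vsum-c ⊎-↔ fe↔′ (suc n) m ⟨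
    (Fin (f n c m) ⊎ Fin (fe (suc n) m))                                   ↔⟨ Finₚ.+↔⊎ ⟨
    Fin (f n c m + fe (suc n) m)                                           ∎)

  fe-zero↔ : ∀ m → Fin (fe 0 m) ↔ (m ≡ 0)
  fe-zero↔ m = ↔-trans (fe↔′ 0 m) (Max-zero↔ c m)

  exact-zero : fromℕcoeffs (fe 0) ≈S one
  exact-zero zero = cong +_ (↔⇒≡ (↔-trans (fe-zero↔ 0)
    (mk↔ₛ′ (λ _ → Fin.zero) (λ _ → refl) (λ { Fin.zero → refl ; (Fin.suc ()) }) (λ _ → ℕₚ.≡-irrelevant _ _))))
  exact-zero (suc m) = cong +_ (↔⇒≡ (↔-trans (fe-zero↔ (suc m)) (mk↔ₛ′ (λ ()) (λ ()) (λ ()) (λ ()))))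

  otherTerms : ℕ → ℕ → ℕ
  otherTerms n m = sum (map (λ d → shift 0 (weight n c d) (f n d) m) (compositionsExcept r ℓ c))

  others↔ : ∀ n m → Fin (otherTerms n m) ↔ OtherProfile n ℓ c m
  others↔ n m = begin
    Fin (sum (map g (compositionsExcept r ℓ c)))                  ↔⟨ Fin-sum g _ ⟩
    AnyL (Fin ∘ g) (List.filter (isOther? ℓ c) (boxVecs r ℓ))     ↔⟨ Any-filter (isOther? ℓ c) (boxVecs r ℓ) (Fin ∘ g) ⟩
    AnyL (λ d → Other d × Fin (g d)) (boxVecs r ℓ)                ↔⟨ Any-boxVecs r ℓ _ ⟩
    Σ (Vec ℕ r) (λ d → All (_< suc ℓ) d × (Other d × Fin (g d)))  ↔⟨ drop-box ⟩
    Σ (Vec ℕ r) (λ d → Other d × Fin (g d))                       ↔⟨ Σₚ.congˡ (×-congʳ-under (fibre _)) ⟩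
    OtherProfile n ℓ c m                                          ∎
    where
    g : Vec ℕ r → ℕ
    g d = shift 0 (weight n c d) (f n d) m
    Other : Vec ℕ r → Set
    Other d = T (does (isOther? ℓ c d))
    vsum-d : ∀ d → Other d → vsum d ≡ ℓ
    vsum-d d other = proj₁ (does⁻ (isOther? ℓ c d) other)
    fibre : ∀ d → Other d → Fin (g d) ↔ Remainder n ℓ c m d
    fibre d other = Fin-shift (CylindricAtMost d n) size (f n d) (CylindricAtMost-irrelevant d n)
                              (λ m → f↔′ n d m (vsum-d d other)) (weight n c d) m
    in-box : ∀ {k} (d : Vec ℕ k) {B} → vsum d ≤ B → All (_< suc B) d
    in-box [] _ = []
    in-box (x ∷ d) Σ≤B = s≤s (ℕₚ.≤-trans (ℕₚ.m≤m+n x (vsum d)) Σ≤B) ∷ in-box d (ℕₚ.≤-trans (ℕₚ.m≤n+m (vsum d) x) Σ≤B)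
    drop-box : Σ (Vec ℕ r) (λ d → All (_< suc ℓ) d × (Other d × Fin (g d))) ↔ Σ (Vec ℕ r) (λ d → Other d × Fin (g d))
    drop-box = mk↔ₛ′ (λ (d , _ , p) → d , p) (λ (d , p) → d , in-box d (ℕₚ.≤-reflexive (vsum-d d (proj₁ p))) , p)
      (λ _ → refl) (λ (d , b , p) → cong (λ b → d , b , p) (All.irrelevant ℕₚ.≤-irrelevant _ _))

  exact-suc : ∀ n m → fe (suc n) m ≡ shift 0 (suc n * r) (f (suc n) c) m + otherTerms n m
  exact-suc n m = ↔⇒≡ (begin
    Fin (fe (suc n) m)
      ↔⟨ fe↔′ (suc n) m ⟩
    OfSize (CylindricMax c (suc n)) m
      ↔⟨ split-by _ (λ Λ → hasZero (Vec.map (leading (suc n)) Λ)) ⟩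
    (AllContainN n c m ⊎ SomeLacksN n ℓ c m)
      ↔⟨ remove-one-N↔ n c m ⊎-↔ remove-all-N↔ n ℓ c vsum-c m ⟩
    (Σ (Vec (List ℕ) r) (λ μ → CylindricAtMost c (suc n) μ × suc n * r + size μ ≡ m) ⊎ OtherProfile n ℓ c m)
      ↔⟨ Fin-shift _ size (f (suc n) c) (CylindricAtMost-irrelevant c (suc n)) (λ m → f↔′ (suc n) c m vsum-c) (suc n * r) m
         ⊎-↔ others↔ n m ⟨
    (Fin (shift 0 (suc n * r) (f (suc n) c) m) ⊎ Fin (otherTerms n m))
      ↔⟨ Finₚ.+↔⊎ ⟨
    Fin (shift 0 (suc n * r) (f (suc n) c) m + otherTerms n m) ∎)

theorem11 : (r ℓ : ℕ) → 1 ≤ r → 1 ≤ ℓ →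
    (c : Vec ℕ r) → vsum c ≡ ℓ →
    (f : ℕ → Vec ℕ r → ℕ → ℕ) →
    (∀ n d m → vsum d ≡ ℓ → Fin (f n d m) ↔ CPbounded r d n m) →
    (fe : ℕ → ℕ → ℕ) →
    (∀ n m → Fin (fe n m) ↔ CPexact r c n m) →
    ∀ n → (pochR r n ⊛ fromℕcoeffs (fe n)) ≈S Pexact r ℓ f c n
theorem11 (suc k) ℓ _ _ c vsum-c f f↔ fe fe↔ zero m =
  trans (monomial-⊛ 0 (fromℕcoeffs (fe 0)) m) (exact-zero m)
  where open Coefficients ℓ c vsum-c f f↔ fe fe↔
theorem11 (suc k) ℓ _ _ c vsum-c f f↔ fe fe↔ (suc n) =
  exact-recurrence (suc k) n (f n c) (f (suc n) c) (fe (suc n)) (f n) (weight n c) (compositionsExcept (suc k) ℓ c)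
    (bounded-suc n) (exact-suc n)
  where open Coefficients ℓ c vsum-c f f↔ fe fe↔
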